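{- Let $K$ be a field of characteristic different from $2$, let $n\ge 1$, and let $R=K[a_{i,j}\mid 1\le i<j\le 2n]$ be the polynomial ring in the ${2n\choose 2}$ indeterminates $a_{i,j}$, $i<j$. Put $a_{j,i}:=a_{i,j}$ for $i<j$ (symmetric generators), and let $S_{2n}$ act on $R$ by $K$-algebra automorphisms determined on generators by $\sigma\, a_{i,j}=a_{\sigma^{ -1}(i),\sigma^{ -1}(j)}$. Let $$pf_{2n}=\sum_{\pi\in S_{2n,pf}}\operatorname{sign}(\pi)\, a_{i_1,j_1}a_{i_2,j_2}\cdots a_{i_n,j_n}\in R$$ be the Pfaffian polynomial (notation in the context). Then the symmetry group $$\operatorname{Sym}(pf_{2n})=\{\sigma\in S_{2n}\mid \sigma\, pf_{2n}=pf_{2n}\}$$ is isomorphic to (indeed equal to) the dihedral group $D_{2n}\subseteq S_{2n}$.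
   Context: $S_{2n,pf}$ is the set of "Pfaff permutations": permutations $\pi\in S_{2n}$ whose one-line notation is $\pi=(i_1,j_1,i_2,j_2,\ldots,i_n,j_n)$ (i.e. $\pi(2s-1)=i_s$, $\pi(2s)=j_s$) with $i_1<i_2<\cdots<i_n$ and $i_s<j_s$ for all $1\le s\le n$; $\operatorname{sign}(\pi)$ is the usual sign of the permutation. $D_{2n}$ denotes the dihedral group realized as the group of permutations of $\{1,\ldots,2n\}$ induced by the symmetries of a regular $2n$-gon whose vertices are labelled $1,2,\ldots,2n$ in cyclic order; equivalently the subgroup of $S_{2n}$ generated by the cyclic shift $i\mapsto i+1 \pmod{2n}$ and the reflection fixing $1$ and sending $i\mapsto 2n+2-i$ for $2\le i\le 2n$. -}

module Defs where

open import Level using (_⊔_; suc)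
open import Data.Nat as ℕ using (ℕ; zero; suc)
open import Data.Fin as F using (Fin; toℕ)
open import Data.Bool using (Bool; true; false; _∧_; _∨_; not; if_then_else_)
open import Data.List using (List; []; _∷_; map; foldr; concatMap; filter; allFin; length)
open import Data.Vec as V using (Vec; []; _∷_)
open import Data.Product using (Σ; _×_; _,_; proj₁; proj₂)
open import Data.Sum using (_⊎_)
open import Data.Integer as ℤ using (ℤ; +_)
open import Data.Integer.Divisibility as ℤD using ()
open import Relation.Nullary using (¬_)
open import Relation.Nullary.Decidable using (⌊_⌋)
open import Algebra.Bundles using (CommutativeRing)
open import Data.Fin.Permutation using (Permutation′; _⟨$⟩ʳ_; _⟨$⟩ˡ_)

record Field (c ℓ : Level.Level) : Set (Level.suc (c ⊔ ℓ)) where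
  field
    commutativeRing : CommutativeRing c ℓ
  open CommutativeRing commutativeRing public
  field
    1≉0     : ¬ (1# ≈ 0#)
    inverse : ∀ x → ¬ (x ≈ 0#) → Σ Carrier (λ y → (x * y) ≈ 1#)

CharNot2 : ∀ {c ℓ} → Field c ℓ → Set ℓ
CharNot2 K = ¬ ((1# + 1#) ≈ 0#)
  where open Field K

-- Boolean helpers on Fin (labels 1..m are represented by Fin m = 0..m-1,
-- an order-preserving relabelling).

_<ᵇ_ : ∀ {m} → Fin m → Fin m → Bool
i <ᵇ j = toℕ i ℕ.<ᵇ toℕ j

_==_ : ∀ {m} → Fin m → Fin m → Bool
i == j = toℕ i ℕ.≡ᵇ toℕ j

vecsOf : ∀ {A : Set} → List A → (k : ℕ) → List (Vec A k)
vecsOf xs zero    = [] ∷ []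
vecsOf xs (suc k) = concatMap (λ x → map (x ∷_) (vecsOf xs k)) xs

allB : ∀ {A : Set} → (A → Bool) → List A → Bool
allB p = foldr (λ x b → p x ∧ b) true

anyB : ∀ {A : Set} → (A → Bool) → List A → Bool
anyB p = foldr (λ x b → p x ∨ b) false

-- Pfaff permutations of {1..2n}, given by their one-line notation
-- (i₁,j₁,i₂,j₂,…,iₙ,jₙ), recorded as the vector of pairs (i_s , j_s).

oneLine : ∀ {m k} → Vec (Fin m × Fin m) k → List (Fin m)
oneLine []             = []
oneLine ((i , j) ∷ ps) = i ∷ j ∷ oneLine ps

-- no repetition (a list of length 2n with entries in Fin (2n) and no
-- repetition is exactly the one-line notation of a permutation)
distinct : ∀ {m} → List (Fin m) → Bool
distinct []       = true
distinct (x ∷ xs) = not (anyB (x ==_) xs) ∧ distinct xs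

increasingFirsts : ∀ {m k} → Vec (Fin m × Fin m) k → Bool
increasingFirsts []                              = true
increasingFirsts (_ ∷ [])                        = true
increasingFirsts ((i , _) ∷ (i' , j') ∷ ps)      =
  (i <ᵇ i') ∧ increasingFirsts ((i' , j') ∷ ps)

isPfaff : ∀ {m k} → Vec (Fin m × Fin m) k → Bool
isPfaff ps = distinct (oneLine ps)
           ∧ increasingFirsts ps
           ∧ allB (λ p → proj₁ p <ᵇ proj₂ p) (V.toList ps)

PfaffPerms : (n : ℕ) → List (Vec (Fin (2 ℕ.* n) × Fin (2 ℕ.* n)) n)
PfaffPerms n = filter (λ ps → isPfaff ps Data.Bool.≟ true)
                      (vecsOf (concatMap (λ i → map (i ,_) (allFin _)) (allFin _)) n)
  where import Data.Bool

inversions : ∀ {m} → List (Fin m) → ℕ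
inversions []       = 0
inversions (x ∷ xs) = length (filter (λ y → y F.<? x) xs) ℕ.+ inversions xs

isEven : ℕ → Bool
isEven zero          = true
isEven (suc zero)    = false
isEven (suc (suc k)) = isEven k

-- A monomial is a finite product of symmetric generators a_{i,j}=a_{j,i},
-- written as the list of its index pairs; a polynomial is a formal
-- K-linear combination of monomials (a list of terms).  Two polynomials
-- are equal iff every monomial has the same coefficient in both.

module Poly {c ℓ} (K : CommutativeRing c ℓ) (m : ℕ) where
  open CommutativeRing K

  Monomial : Set
  Monomial = List (Fin m × Fin m)

  Polynomial : Set c
  Polynomial = List (Carrier × Monomial)

  isGen : Fin m → Fin m → (Fin m × Fin m) → Bool
  isGen i j (k , l) = ((i == k) ∧ (j == l)) ∨ ((i == l) ∧ (j == k))

  expo : Monomial → Fin m → Fin m → ℕ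
  expo μ i j = length (filter (λ p → isGen i j p Data.Bool.≟ true) μ)
    where import Data.Bool

  sameMonomial : Monomial → Monomial → Bool
  sameMonomial μ ν = allB (λ i → allB (λ j → expo μ i j ℕ.≡ᵇ expo ν i j) (allFin m)) (allFin m)

  coeff : Monomial → Polynomial → Carrier
  coeff μ []             = 0#
  coeff μ ((a , ν) ∷ ts) = (if sameMonomial μ ν then a else 0#) + coeff μ ts

  _≈ₚ_ : Polynomial → Polynomial → Set ℓ
  p ≈ₚ q = ∀ (μ : Monomial) → coeff μ p ≈ coeff μ q

  -- S_m acts by K-algebra automorphisms, σ a_{i,j} = a_{σ⁻¹ i, σ⁻¹ j}
  actMon : Permutation′ m → Monomial → Monomial
  actMon σ = map (λ p → (σ ⟨$⟩ˡ proj₁ p , σ ⟨$⟩ˡ proj₂ p))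

  act : Permutation′ m → Polynomial → Polynomial
  act σ = map (λ t → (proj₁ t , actMon σ (proj₂ t)))

  signK : ℕ → Carrier
  signK k = if isEven k then 1# else - 1#

pf : ∀ {c ℓ} (K : CommutativeRing c ℓ) (n : ℕ) → Poly.Polynomial K (2 ℕ.* n)
pf K n = map (λ ps → (signK (inversions (oneLine ps)) , V.toList ps)) (PfaffPerms n)
  where open Poly K (2 ℕ.* n)

-- The dihedral group D_{2n} ⊆ S_{2n}: the permutations induced by the
-- symmetries of the regular m-gon with vertices labelled cyclically,
-- i.e. the rotations i ↦ i + k and the reflections i ↦ k − i (mod m).

Dihedral : (m : ℕ) → Permutation′ m → Set
Dihedral m σ = Σ ℕ λ k →
    (∀ i → (+ m) ℤD.∣ ((+ toℕ (σ ⟨$⟩ʳ i)) ℤ.- ((+ toℕ i) ℤ.+ (+ k))))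
  ⊎ (∀ i → (+ m) ℤD.∣ ((+ toℕ (σ ⟨$⟩ʳ i)) ℤ.+ (+ toℕ i) ℤ.- (+ k)))

-- The coefficient of a monomial a_{i₁j₁}⋯a_{iₙjₙ} in pf_{2n} vanishes unless the chords
-- {iₛ, jₛ} form a perfect matching of the vertices of the 2n-gon, and it is then (−1)^c,
-- where c is the number of crossing pairs of chords: the inversions of the Pfaff permutation
-- of the matching have the parity of its crossings. As 1 ≠ −1, σ fixes pf_{2n} iff it
-- preserves the crossing parity of every perfect matching. A dihedral symmetry preserves the
-- cyclic order up to orientation, hence every crossing. Conversely, comparing matchings that
-- differ only in how four given points are paired shows that σ preserves whether two
-- disjoint chords cross. A side of the polygon crosses no chord while every diagonal crosses
-- one, so σ maps sides to sides, and then it is dihedral.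

module Submission where

open import Defs
open import Data.Bool using (Bool; true; false; _∧_; _∨_; not; if_then_else_; _xor_)
import Data.Bool as B
open import Data.Bool.Properties using (xor-assoc; xor-identityʳ; ∧-comm; ∨-comm; ∧-conicalˡ; ∧-conicalʳ; not-injective; T-≡)
open import Data.Bool.Solver using (module xor-∧-Solver)
open import Data.Empty using (⊥-elim)
open import Data.Unit using (⊤; tt)
open import Data.Sum using (_⊎_; inj₁; inj₂)
open import Data.Fin as F using (Fin; toℕ)
open import Data.Fin.Properties using (toℕ-injective; toℕ<n; toℕ-fromℕ<)
open import Data.List using (List; []; _∷_; map; filter; length; foldr; concatMap; _++_; allFin)
open import Data.List.Properties using (map-∘; map-cong; map-cong-local; map-id; length-tabulate)
open import Data.List.Relation.Binary.Permutation.Propositional as ↭ using (_↭_; ↭-refl; ↭-sym; ↭-trans; ↭⇒↭ₛ)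
import Data.List.Relation.Binary.Permutation.Setoid.Properties as PermutationSetoid
open import Data.List.Relation.Binary.Permutation.Propositional.Properties using (All-resp-↭)
open import Data.List.Relation.Unary.All as All using (All; []; _∷_)
open import Data.List.Relation.Unary.AllPairs using ([]; _∷_)
open import Data.List.Relation.Unary.Any using (here; there; any?; satisfied)
open import Data.List.Relation.Unary.All.Properties using (¬Any⇒All¬) renaming (map⁻ to All-map⁻)
open import Data.List.Membership.Propositional using (_∈_)
open import Data.List.Relation.Unary.Unique.Propositional using (Unique)
import Data.List.Relation.Unary.Unique.Propositional.Properties as Unique
open import Data.List.Relation.Unary.Unique.Propositional.Properties using (allFin⁺)
open import Data.List.Membership.Propositional.Properties using (∈-allFin)
open import Data.Nat as ℕ using (ℕ; zero; suc; _*_; _<_; _≤_; z≤n; s≤s; NonZero)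
import Data.Integer as ℤ
open import Data.Nat.DivMod using (_%_)
import Data.Integer.Divisibility as ℤD
open import Data.Nat.Properties using (<-trans; <-irrefl; <-asym; ≡ᵇ⇒≡; ≡⇒≡ᵇ; suc-injective; *-comm)
open import Data.Vec as V using (Vec; []; _∷_)
open import Data.Vec.Properties using (toList-map)
open import Data.Fin.Permutation as Perm using (Permutation′; _⟨$⟩ʳ_; _⟨$⟩ˡ_; inverseˡ; inverseʳ; flip)
import Data.Fin.Permutation.Components as PC
open import Data.Product using (Σ; _×_; _,_; proj₁; proj₂; uncurry)
open import Algebra.Bundles using (CommutativeRing)
open import Relation.Binary.PropositionalEquality
  using (_≡_; _≢_; refl; sym; trans; cong; cong₂; subst; subst₂; module ≡-Reasoning)
  renaming (setoid to ≡-setoid)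
open import Relation.Nullary using (¬_; Dec; yes; no)
open import Relation.Nullary.Decidable using (dec-true; dec-false)
open import Function using (_∘_; Injective)
open import Function.Bundles using (Equivalence; _⇔_; mk⇔)

open xor-∧-Solver using (solve; _:+_; _:=_; con)

<ᵇ-complete : ∀ {a b} → a < b → (a ℕ.<ᵇ b) ≡ true
<ᵇ-complete {zero}  {suc b} _       = refl
<ᵇ-complete {suc a} {suc b} (s≤s p) = <ᵇ-complete p

<ᵇ-sound : ∀ {a b} → (a ℕ.<ᵇ b) ≡ true → a < b
<ᵇ-sound {zero}  {suc b} _ = s≤s z≤n
<ᵇ-sound {suc a} {suc b} e = s≤s (<ᵇ-sound e)

≮ᵇ-complete : ∀ {a b} → b ≤ a → (a ℕ.<ᵇ b) ≡ false
≮ᵇ-complete {a}     {zero}  _       = refl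
≮ᵇ-complete {suc a} {suc b} (s≤s p) = ≮ᵇ-complete p

≮ᵇ-sound : ∀ {a b} → (a ℕ.<ᵇ b) ≡ false → b ≤ a
≮ᵇ-sound {a}     {zero}  _ = z≤n
≮ᵇ-sound {suc a} {suc b} e = s≤s (≮ᵇ-sound e)

<ᵇ-suc : ∀ p i → p ≢ i → (p ℕ.<ᵇ suc i) ≡ (p ℕ.<ᵇ i)
<ᵇ-suc zero    zero    ne = ⊥-elim (ne refl)
<ᵇ-suc zero    (suc i) _  = refl
<ᵇ-suc (suc p) zero    _  = refl
<ᵇ-suc (suc p) (suc i) ne = <ᵇ-suc p i (ne ∘ cong suc)

<ᵇ-flipℕ : ∀ a b → a ≢ b → (b ℕ.<ᵇ a) ≡ not (a ℕ.<ᵇ b)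
<ᵇ-flipℕ zero    zero    ne = ⊥-elim (ne refl)
<ᵇ-flipℕ zero    (suc b) _  = refl
<ᵇ-flipℕ (suc a) zero    _  = refl
<ᵇ-flipℕ (suc a) (suc b) ne = <ᵇ-flipℕ a b (ne ∘ cong suc)

count : ∀ {A : Set} → (A → Bool) → List A → ℕ
count b []       = 0
count b (x ∷ xs) = if b x then suc (count b xs) else count b xs

count-map : ∀ {A B : Set} (b : A → Bool) (c : B → Bool) (f : B → A) → (∀ x → b (f x) ≡ c x) →
  ∀ xs → count b (map f xs) ≡ count c xs
count-map b c f b∘f≗c []       = refl
count-map b c f b∘f≗c (x ∷ xs) rewrite b∘f≗c x with c x
... | true  = cong suc (count-map b c f b∘f≗c xs)
... | false = count-map b c f b∘f≗c xs

count-↭ : ∀ {A : Set} (b : A → Bool) {xs ys : List A} → xs ↭ ys → count b xs ≡ count b ys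
count-↭ b ↭.refl       = refl
count-↭ b (↭.prep x p) with b x
... | true  = cong suc (count-↭ b p)
... | false = count-↭ b p
count-↭ b (↭.swap x y p) with b x | b y
... | true  | true  = cong (suc ∘ suc) (count-↭ b p)
... | true  | false = cong suc (count-↭ b p)
... | false | true  = cong suc (count-↭ b p)
... | false | false = count-↭ b p
count-↭ b (↭.trans p q) = trans (count-↭ b p) (count-↭ b q)

length-filter≡count : ∀ {A : Set} (b : A → Bool) xs → length (filter (λ x → b x B.≟ true) xs) ≡ count b xs
length-filter≡count b []       = refl
length-filter≡count b (x ∷ xs) with b x
... | true  = cong suc (length-filter≡count b xs)
... | false = length-filter≡count b xs

true≢false : true ≢ false
true≢false ()

Bool-ext : ∀ {a b : Bool} → (a ≡ true → b ≡ true) → (b ≡ true → a ≡ true) → a ≡ b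
Bool-ext {true}  {true}  _ _ = refl
Bool-ext {false} {false} _ _ = refl
Bool-ext {true}  {false} f _ = sym (f refl)
Bool-ext {false} {true}  _ g = g refl

∧-true : ∀ {a b} → a ∧ b ≡ true → a ≡ true × b ≡ true
∧-true {a} {b} e = ∧-conicalˡ a b e , ∧-conicalʳ a b e

allB-sound : ∀ {A : Set} (p : A → Bool) xs → allB p xs ≡ true → All (λ x → p x ≡ true) xs
allB-sound p []       _ = []
allB-sound p (x ∷ xs) e = proj₁ (∧-true e) ∷ allB-sound p xs (proj₂ (∧-true e))

allB-complete : ∀ {A : Set} (p : A → Bool) xs → All (λ x → p x ≡ true) xs → allB p xs ≡ true
allB-complete p []       []       = refl
allB-complete p (x ∷ xs) (e ∷ es) rewrite e = allB-complete p xs es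

xorMap : ∀ {A : Set} → (A → Bool) → List A → Bool
xorMap f []       = false
xorMap f (x ∷ xs) = f x xor xorMap f xs

xorMap-↭ : ∀ {A : Set} (f : A → Bool) {xs ys : List A} → xs ↭ ys → xorMap f xs ≡ xorMap f ys
xorMap-↭ f ↭.refl         = refl
xorMap-↭ f (↭.prep x p)   = cong (f x xor_) (xorMap-↭ f p)
xorMap-↭ f (↭.swap x y p) rewrite xorMap-↭ f p =
  solve 3 (λ a b r → a :+ (b :+ r) := b :+ (a :+ r)) refl (f x) (f y) _
xorMap-↭ f (↭.trans p q)  = trans (xorMap-↭ f p) (xorMap-↭ f q)

xorMap-map : ∀ {A B : Set} (g : B → Bool) (h : A → Bool) (f : A → B) (xs : List A) →
  All (λ x → g (f x) ≡ h x) xs → xorMap g (map f xs) ≡ xorMap h xs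
xorMap-map g h f []       []       = refl
xorMap-map g h f (x ∷ xs) (e ∷ es) = cong₂ _xor_ e (xorMap-map g h f xs es)

Unique-resp-↭ : ∀ {A : Set} {xs ys : List A} → xs ↭ ys → Unique xs → Unique ys
Unique-resp-↭ p = PermutationSetoid.Unique-resp-↭ (≡-setoid _) (↭⇒↭ₛ p)

odd : ℕ → Bool
odd k = not (isEven k)

odd-suc : ∀ k → odd (suc k) ≡ not (odd k)
odd-suc zero          = refl
odd-suc (suc zero)    = refl
odd-suc (suc (suc k)) = odd-suc k

odd-+ : ∀ a b → odd (a ℕ.+ b) ≡ odd a xor odd b
odd-+ zero    b = refl
odd-+ (suc a) b rewrite odd-suc (a ℕ.+ b) | odd-+ a b | odd-suc a =
  solve 2 (λ x y → con true :+ (x :+ y) := (con true :+ x) :+ y) refl (odd a) (odd b)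

odd-count : ∀ {A : Set} (b : A → Bool) x xs → odd (count b (x ∷ xs)) ≡ b x xor odd (count b xs)
odd-count b x xs with b x
... | true  = odd-suc (count b xs)
... | false = refl

module _ {m : ℕ} where

  <ᵇ-flip : ∀ (a b : Fin m) → a ≢ b → b <ᵇ a ≡ not (a <ᵇ b)
  <ᵇ-flip a b ne = <ᵇ-flipℕ (toℕ a) (toℕ b) (ne ∘ toℕ-injective)

  <ᵇ-trans : ∀ (a b c : Fin m) → a <ᵇ b ≡ true → b <ᵇ c ≡ true → a <ᵇ c ≡ true
  <ᵇ-trans a b c p q = <ᵇ-complete (<-trans (<ᵇ-sound {toℕ a} {toℕ b} p) (<ᵇ-sound {toℕ b} {toℕ c} q))

  <ᵇ-irrefl : ∀ (a : Fin m) → a <ᵇ a ≢ true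
  <ᵇ-irrefl a p = <-irrefl refl (<ᵇ-sound {toℕ a} {toℕ a} p)

  <ᵇ-asym : ∀ (a b : Fin m) → a <ᵇ b ≡ true → b <ᵇ a ≢ true
  <ᵇ-asym a b p q = <-asym (<ᵇ-sound {toℕ a} {toℕ b} p) (<ᵇ-sound {toℕ b} {toℕ a} q)

  ==-sound : ∀ {i j : Fin m} → i == j ≡ true → i ≡ j
  ==-sound {i} {j} e = toℕ-injective (≡ᵇ⇒≡ (toℕ i) (toℕ j) (Equivalence.from T-≡ e))

  ==-refl : ∀ (i : Fin m) → i == i ≡ true
  ==-refl i = Equivalence.to T-≡ (≡⇒≡ᵇ (toℕ i) (toℕ i) refl)

  ==-false : ∀ {i j : Fin m} → i ≢ j → i == j ≡ false
  ==-false {i} {j} i≢j with i == j in e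
  ... | true  = ⊥-elim (i≢j (==-sound e))
  ... | false = refl

  anyB-==-sound : ∀ (x : Fin m) xs → anyB (x ==_) xs ≡ false → All (x ≢_) xs
  anyB-==-sound x []       _ = []
  anyB-==-sound x (y ∷ ys) e with x == y in x=y
  ... | false = (λ { refl → true≢false (trans (sym (==-refl x)) x=y) }) ∷ anyB-==-sound x ys e

  anyB-==-complete : ∀ (x : Fin m) xs → All (x ≢_) xs → anyB (x ==_) xs ≡ false
  anyB-==-complete x []       []         = refl
  anyB-==-complete x (y ∷ ys) (x≢y ∷ ne) rewrite ==-false x≢y = anyB-==-complete x ys ne

  distinct-sound : ∀ (xs : List (Fin m)) → distinct xs ≡ true → Unique xs
  distinct-sound []       _ = []
  distinct-sound (x ∷ xs) e with ∧-true {not (anyB (x ==_) xs)} e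
  ... | fresh , rest = anyB-==-sound x xs (not-injective fresh) ∷ distinct-sound xs rest

  distinct-complete : ∀ (xs : List (Fin m)) → Unique xs → distinct xs ≡ true
  distinct-complete []       []         = refl
  distinct-complete (x ∷ xs) (fresh ∷ u) rewrite anyB-==-complete x xs fresh = distinct-complete xs u

-- Chords and crossings

Chord : ℕ → Set
Chord m = Fin m × Fin m

record Distinct₄ {m} (a b p q : Fin m) : Set where
  field
    ab : a ≢ b
    ap : a ≢ p
    aq : a ≢ q
    bp : b ≢ p
    bq : b ≢ q
    pq : p ≢ q

module _ {m : ℕ} {a b c d : Fin m} where

  Distinct₄⇒Unique : Distinct₄ a b c d → Unique (a ∷ b ∷ c ∷ d ∷ [])
  Distinct₄⇒Unique abcd = (ab ∷ ap ∷ aq ∷ []) ∷ (bp ∷ bq ∷ []) ∷ (pq ∷ []) ∷ [] ∷ []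
    where open Distinct₄ abcd

  Unique⇒Distinct₄ : ∀ {xs} → Unique (a ∷ b ∷ c ∷ d ∷ xs) → Distinct₄ a b c d
  Unique⇒Distinct₄ ((a≢b ∷ a≢c ∷ a≢d ∷ _) ∷ (b≢c ∷ b≢d ∷ _) ∷ (c≢d ∷ _) ∷ _) =
    record { ab = a≢b ; ap = a≢c ; aq = a≢d ; bp = b≢c ; bq = b≢d ; pq = c≢d }

module _ {m : ℕ} where

  endpoints : List (Chord m) → List (Fin m)
  endpoints []             = []
  endpoints ((a , b) ∷ cs) = a ∷ b ∷ endpoints cs

  -- When the four endpoints are distinct: whether exactly one endpoint of
  -- the second chord lies between the endpoints of the first.
  separates : Chord m → Chord m → Bool
  separates (a , b) (p , q) = ((p <ᵇ a xor p <ᵇ b) xor q <ᵇ a) xor q <ᵇ b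

  crosses : Chord m → Chord m → Bool
  crosses x y = separates x y ∧ separates y x

  separates-sym : ∀ {a b p q : Fin m} → Distinct₄ a b p q → separates (p , q) (a , b) ≡ separates (a , b) (p , q)
  separates-sym {a} {b} {p} {q} d
    rewrite <ᵇ-flip p a (Distinct₄.ap d ∘ sym) | <ᵇ-flip q a (Distinct₄.aq d ∘ sym)
          | <ᵇ-flip p b (Distinct₄.bp d ∘ sym) | <ᵇ-flip q b (Distinct₄.bq d ∘ sym) =
    solve 4 (λ w x y z → (((con true :+ w) :+ (con true :+ x)) :+ (con true :+ y)) :+ (con true :+ z)
                         := ((w :+ y) :+ x) :+ z) refl (p <ᵇ a) (q <ᵇ a) (p <ᵇ b) (q <ᵇ b)

  crosses≡separates : ∀ {a b p q : Fin m} → Distinct₄ a b p q → crosses (a , b) (p , q) ≡ separates (a , b) (p , q)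
  crosses≡separates {a} {b} {p} {q} d rewrite separates-sym d with separates (a , b) (p , q)
  ... | true  = refl
  ... | false = refl

  crosses-sym : ∀ (x y : Chord m) → crosses x y ≡ crosses y x
  crosses-sym x y = ∧-comm (separates x y) (separates y x)

  separates-swapˡ : ∀ (a b : Fin m) y → separates (b , a) y ≡ separates (a , b) y
  separates-swapˡ a b (p , q) =
    solve 4 (λ pa pb qa qb → ((pb :+ pa) :+ qb) :+ qa := ((pa :+ pb) :+ qa) :+ qb) refl
      (p <ᵇ a) (p <ᵇ b) (q <ᵇ a) (q <ᵇ b)

  separates-swapʳ : ∀ x (p q : Fin m) → separates x (q , p) ≡ separates x (p , q)
  separates-swapʳ (a , b) p q =
    solve 4 (λ pa pb qa qb → ((qa :+ qb) :+ pa) :+ pb := ((pa :+ pb) :+ qa) :+ qb) refl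
      (p <ᵇ a) (p <ᵇ b) (q <ᵇ a) (q <ᵇ b)

  crosses-swapʳ : ∀ (x : Chord m) p q → crosses x (q , p) ≡ crosses x (p , q)
  crosses-swapʳ x p q = cong₂ _∧_ (separates-swapʳ x p q) (separates-swapˡ p q x)

  crosses-swapˡ : ∀ (a b : Fin m) y → crosses (b , a) y ≡ crosses (a , b) y
  crosses-swapˡ a b y = cong₂ _∧_ (separates-swapˡ a b y) (separates-swapʳ y a b)

  Disjoint : Chord m → Chord m → Set
  Disjoint (a , b) (p , q) = Distinct₄ a b p q

  IsMatching : List (Chord m) → Set
  IsMatching cs = Unique (endpoints cs)

  crossingParity : List (Chord m) → Bool
  crossingParity []       = false
  crossingParity (c ∷ cs) = xorMap (crosses c) cs xor crossingParity cs

  endpoints-↭ : ∀ {cs ds : List (Chord m)} → cs ↭ ds → endpoints cs ↭ endpoints ds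
  endpoints-↭ ↭.refl                      = ↭-refl
  endpoints-↭ (↭.prep (a , b) p)          = ↭.prep a (↭.prep b (endpoints-↭ p))
  endpoints-↭ (↭.swap (a , b) (c , d) p) =
    ↭-trans (↭.prep a (↭.swap b c (↭.prep d (endpoints-↭ p))))
    (↭-trans (↭.swap a c ↭-refl) (↭-trans (↭.prep c (↭.prep a (↭.swap b d ↭-refl))) (↭.prep c (↭.swap a d ↭-refl))))
  endpoints-↭ (↭.trans p q)               = ↭-trans (endpoints-↭ p) (endpoints-↭ q)

  crossingParity-↭ : ∀ {cs ds : List (Chord m)} → cs ↭ ds → crossingParity cs ≡ crossingParity ds
  crossingParity-↭ ↭.refl = refl
  crossingParity-↭ (↭.prep c p) = cong₂ _xor_ (xorMap-↭ (crosses c) p) (crossingParity-↭ p)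
  crossingParity-↭ {ds = d ∷ c ∷ ds} (↭.swap c d p)
    rewrite xorMap-↭ (crosses c) p | xorMap-↭ (crosses d) p | crossingParity-↭ p | crosses-sym c d =
    solve 4 (λ x C D r → (x :+ C) :+ (D :+ r) := (x :+ D) :+ (C :+ r)) refl
      (crosses d c) (xorMap (crosses c) ds) (xorMap (crosses d) ds) (crossingParity ds)
  crossingParity-↭ (↭.trans p q) = trans (crossingParity-↭ p) (crossingParity-↭ q)

  Disjoint-all : ∀ {a b : Fin m} cs → a ≢ b → All (a ≢_) (endpoints cs) → All (b ≢_) (endpoints cs) →
    IsMatching cs → All (Disjoint (a , b)) cs
  Disjoint-all []             _  _                 _                 _ = []
  Disjoint-all ((p , q) ∷ cs) ab (ap ∷ aq ∷ a∉) (bp ∷ bq ∷ b∉) ((pq ∷ _) ∷ (_ ∷ u)) =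
    record { ab = ab ; ap = ap ; aq = aq ; bp = bp ; bq = bq ; pq = pq } ∷ Disjoint-all cs ab a∉ b∉ u

  crossingParity-map : (f : Chord m → Chord m) → (∀ x y → Disjoint x y → crosses (f x) (f y) ≡ crosses x y) →
    ∀ cs → IsMatching cs → crossingParity (map f cs) ≡ crossingParity cs
  crossingParity-map f f-cross []             _ = refl
  crossingParity-map f f-cross ((a , b) ∷ cs) ((ab ∷ a∉) ∷ (b∉ ∷ u)) =
    cong₂ _xor_ (xorMap-map (crosses (f (a , b))) (crosses (a , b)) f cs
                  (All.map (f-cross (a , b) _) (Disjoint-all cs ab a∉ b∉ u)))
                (crossingParity-map f f-cross cs u)

-- Pfaff normal form of a matching

module _ {m : ℕ} where

  oneLine≡endpoints : ∀ {k} (v : Vec (Chord m) k) → oneLine v ≡ endpoints (V.toList v)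
  oneLine≡endpoints []            = refl
  oneLine≡endpoints ((a , b) ∷ v) = cong (λ es → a ∷ b ∷ es) (oneLine≡endpoints v)

  Oriented : Chord m → Set
  Oriented (a , b) = a <ᵇ b ≡ true

  FirstsAbove : ∀ {k} → Fin m → Vec (Chord m) k → Set
  FirstsAbove b []       = ⊤
  FirstsAbove b (c ∷ cs) = b <ᵇ proj₁ c ≡ true × FirstsAbove (proj₁ c) cs

  FirstsIncreasing : ∀ {k} → Vec (Chord m) k → Set
  FirstsIncreasing []       = ⊤
  FirstsIncreasing (c ∷ cs) = FirstsAbove (proj₁ c) cs

  record IsPfaffForm {k} (v : Vec (Chord m) k) : Set where
    field
      matching   : IsMatching (V.toList v)
      increasing : FirstsIncreasing v
      oriented   : All Oriented (V.toList v)

  increasingFirsts-sound : ∀ {k} (v : Vec (Chord m) k) → increasingFirsts v ≡ true → FirstsIncreasing v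
  increasingFirsts-sound []                      _ = tt
  increasingFirsts-sound (_ ∷ [])                _ = tt
  increasingFirsts-sound (c ∷ c′ ∷ v) e =
    proj₁ (∧-true {proj₁ c <ᵇ proj₁ c′} e) , increasingFirsts-sound (c′ ∷ v) (proj₂ (∧-true {proj₁ c <ᵇ proj₁ c′} e))

  increasingFirsts-complete : ∀ {k} (v : Vec (Chord m) k) → FirstsIncreasing v → increasingFirsts v ≡ true
  increasingFirsts-complete []                        _            = refl
  increasingFirsts-complete (_ ∷ [])                  _            = refl
  increasingFirsts-complete (c ∷ c′ ∷ v) (c<c′ , rest) =
    cong₂ _∧_ c<c′ (increasingFirsts-complete (c′ ∷ v) rest)

  isPfaff-sound : ∀ {k} (v : Vec (Chord m) k) → isPfaff v ≡ true → IsPfaffForm v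
  isPfaff-sound v e with ∧-true {distinct (oneLine v)} e
  ... | d , e′ with ∧-true {increasingFirsts v} e′
  ... | i , o = record
    { matching   = distinct-sound _ (subst (λ xs → distinct xs ≡ true) (oneLine≡endpoints v) d)
    ; increasing = increasingFirsts-sound v i
    ; oriented   = allB-sound _ (V.toList v) o
    }

  isPfaff-complete : ∀ {k} (v : Vec (Chord m) k) → IsPfaffForm v → isPfaff v ≡ true
  isPfaff-complete v pf-v
    rewrite oneLine≡endpoints v
          | distinct-complete _ (IsPfaffForm.matching pf-v)
          | increasingFirsts-complete v (IsPfaffForm.increasing pf-v) =
    allB-complete _ (V.toList v) (IsPfaffForm.oriented pf-v)

  orient : Chord m → Chord m
  orient (a , b) = if a <ᵇ b then (a , b) else (b , a)

  insert : ∀ {k} → Chord m → Vec (Chord m) k → Vec (Chord m) (suc k)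
  insert c []       = c ∷ []
  insert c (d ∷ ds) = if proj₁ c <ᵇ proj₁ d then c ∷ d ∷ ds else d ∷ insert c ds

  pfaffForm : ∀ {k} → Vec (Chord m) k → Vec (Chord m) k
  pfaffForm []       = []
  pfaffForm (c ∷ cs) = insert (orient c) (pfaffForm cs)

  insert-↭ : ∀ {k} c (v : Vec (Chord m) k) → V.toList (insert c v) ↭ c ∷ V.toList v
  insert-↭ c []       = ↭-refl
  insert-↭ c (d ∷ ds) with proj₁ c <ᵇ proj₁ d
  ... | true  = ↭-refl
  ... | false = ↭-trans (↭.prep d (insert-↭ c ds)) (↭.swap d c ↭-refl)

  pfaffForm-↭ : ∀ {k} (v : Vec (Chord m) k) → V.toList (pfaffForm v) ↭ map orient (V.toList v)
  pfaffForm-↭ []       = ↭-refl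
  pfaffForm-↭ (c ∷ cs) = ↭-trans (insert-↭ (orient c) (pfaffForm cs)) (↭.prep (orient c) (pfaffForm-↭ cs))

  endpoints-orient : ∀ cs → endpoints (map orient cs) ↭ endpoints cs
  endpoints-orient []             = ↭-refl
  endpoints-orient ((a , b) ∷ cs) with a <ᵇ b
  ... | true  = ↭.prep a (↭.prep b (endpoints-orient cs))
  ... | false = ↭.swap b a (endpoints-orient cs)

  endpoints-pfaffForm : ∀ {k} (v : Vec (Chord m) k) → endpoints (V.toList (pfaffForm v)) ↭ endpoints (V.toList v)
  endpoints-pfaffForm v = ↭-trans (endpoints-↭ (pfaffForm-↭ v)) (endpoints-orient (V.toList v))

  orient-oriented : ∀ (a b : Fin m) → a ≢ b → Oriented (orient (a , b))
  orient-oriented a b a≢b with a <ᵇ b in a<b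
  ... | true  = a<b
  ... | false = trans (<ᵇ-flip a b a≢b) (cong not a<b)

  orient-first : ∀ (a b : Fin m) → proj₁ (orient (a , b)) ≡ a ⊎ proj₁ (orient (a , b)) ≡ b
  orient-first a b with a <ᵇ b
  ... | true  = inj₁ refl
  ... | false = inj₂ refl

  map-orient-oriented : ∀ cs → IsMatching cs → All Oriented (map orient cs)
  map-orient-oriented []             _                 = []
  map-orient-oriented ((a , b) ∷ cs) ((a≢b ∷ _) ∷ _ ∷ u) = orient-oriented a b a≢b ∷ map-orient-oriented cs u

  FirstsAvoid : ∀ {k} → Fin m → Vec (Chord m) k → Set
  FirstsAvoid z v = All (λ c → z ≢ proj₁ c) (V.toList v)

  FirstsAbove-insert : ∀ {k} b c (v : Vec (Chord m) k) → FirstsAbove b v → b <ᵇ proj₁ c ≡ true →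
    FirstsAvoid (proj₁ c) v → FirstsAbove b (insert c v)
  FirstsAbove-insert b c []       _            b<c _            = b<c , tt
  FirstsAbove-insert b c (d ∷ ds) (b<d , above) b<c (c≢d ∷ avoid) with proj₁ c <ᵇ proj₁ d in c<d
  ... | true  = b<c , c<d , above
  ... | false = b<d , FirstsAbove-insert (proj₁ d) c ds above (trans (<ᵇ-flip (proj₁ c) (proj₁ d) c≢d) (cong not c<d)) avoid

  FirstsIncreasing-insert : ∀ {k} c (v : Vec (Chord m) k) → FirstsIncreasing v → FirstsAvoid (proj₁ c) v →
    FirstsIncreasing (insert c v)
  FirstsIncreasing-insert c []       _     _             = tt
  FirstsIncreasing-insert c (d ∷ ds) above (c≢d ∷ avoid) with proj₁ c <ᵇ proj₁ d in c<d
  ... | true  = c<d , above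
  ... | false = FirstsAbove-insert (proj₁ d) c ds above (trans (<ᵇ-flip (proj₁ c) (proj₁ d) c≢d) (cong not c<d)) avoid

  avoid-firsts : ∀ (z : Fin m) cs → All (z ≢_) (endpoints cs) → All (λ c → z ≢ proj₁ c) cs
  avoid-firsts z []             _                = []
  avoid-firsts z ((p , q) ∷ cs) (z≢p ∷ _ ∷ avoid) = z≢p ∷ avoid-firsts z cs avoid

  pfaffForm-increasing : ∀ {k} (v : Vec (Chord m) k) → IsMatching (V.toList v) → FirstsIncreasing (pfaffForm v)
  pfaffForm-increasing []             _ = tt
  pfaffForm-increasing ((a , b) ∷ cs) ((a≢b ∷ a∉) ∷ b∉ ∷ u) =
    FirstsIncreasing-insert (orient (a , b)) (pfaffForm cs) (pfaffForm-increasing cs u)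
      (avoid-firsts _ (V.toList (pfaffForm cs)) (All-resp-↭ (↭-sym (endpoints-pfaffForm cs)) first∉))
    where
      first∉ : All (proj₁ (orient (a , b)) ≢_) (endpoints (V.toList cs))
      first∉ with orient-first a b
      ... | inj₁ e rewrite e = a∉
      ... | inj₂ e rewrite e = b∉

  pfaffForm-isPfaffForm : ∀ {k} (v : Vec (Chord m) k) → IsMatching (V.toList v) → IsPfaffForm (pfaffForm v)
  pfaffForm-isPfaffForm v u = record
    { matching   = Unique-resp-↭ (↭-sym (endpoints-pfaffForm v)) u
    ; increasing = pfaffForm-increasing v u
    ; oriented   = All-resp-↭ (↭-sym (pfaffForm-↭ v)) (map-orient-oriented (V.toList v) u)
    }

  joins : Fin m → Fin m → Chord m → Bool
  joins i j (k , l) = ((i == k) ∧ (j == l)) ∨ ((i == l) ∧ (j == k))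

  record SameGenerators (μ ν : List (Chord m)) : Set where
    constructor sameGenerators
    field counts : ∀ i j → count (joins i j) μ ≡ count (joins i j) ν
  open SameGenerators public

  SameGenerators-sym : ∀ {μ ν} → SameGenerators μ ν → SameGenerators ν μ
  SameGenerators-sym same = sameGenerators λ i j → sym (counts same i j)

  SameGenerators-trans : ∀ {μ ν κ} → SameGenerators μ ν → SameGenerators ν κ → SameGenerators μ κ
  SameGenerators-trans same same′ = sameGenerators λ i j → trans (counts same i j) (counts same′ i j)

  joins-orient : ∀ i j c → joins i j (orient c) ≡ joins i j c
  joins-orient i j (a , b) with a <ᵇ b
  ... | true  = refl
  ... | false = ∨-comm ((i == b) ∧ (j == a)) ((i == a) ∧ (j == b))

  pfaffForm-sameGenerators : ∀ {k} (v : Vec (Chord m) k) → SameGenerators (V.toList (pfaffForm v)) (V.toList v)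
  pfaffForm-sameGenerators v = sameGenerators λ i j →
    trans (count-↭ (joins i j) (pfaffForm-↭ v)) (count-map (joins i j) (joins i j) orient (joins-orient i j) (V.toList v))

  separates-orientˡ : ∀ c d → separates (orient c) d ≡ separates c d
  separates-orientˡ (a , b) d with a <ᵇ b
  ... | true  = refl
  ... | false = separates-swapˡ a b d

  separates-orientʳ : ∀ c d → separates c (orient d) ≡ separates c d
  separates-orientʳ c (p , q) with p <ᵇ q
  ... | true  = refl
  ... | false = separates-swapʳ c p q

  crosses-orient : ∀ c d → crosses (orient c) (orient d) ≡ crosses c d
  crosses-orient c d =
    cong₂ _∧_ (trans (separates-orientˡ c (orient d)) (separates-orientʳ c d))
              (trans (separates-orientˡ d (orient c)) (separates-orientʳ d c))

  pfaffForm-crossingParity : ∀ {k} (v : Vec (Chord m) k) → IsMatching (V.toList v) →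
    crossingParity (V.toList (pfaffForm v)) ≡ crossingParity (V.toList v)
  pfaffForm-crossingParity v u =
    trans (crossingParity-↭ (pfaffForm-↭ v)) (crossingParity-map orient (λ c d _ → crosses-orient c d) (V.toList v) u)

  joins-sound : ∀ i j k l → joins i j (k , l) ≡ true → (i ≡ k × j ≡ l) ⊎ (i ≡ l × j ≡ k)
  joins-sound i j k l e with (i == k) ∧ (j == l) in e₁
  ... | true  = inj₁ (==-sound (proj₁ (∧-true e₁)) , ==-sound (proj₂ (∧-true e₁)))
  ... | false = inj₂ (==-sound (proj₁ (∧-true e)) , ==-sound (proj₂ (∧-true e)))

  count-joins-∈ : ∀ a b cs → count (joins a b) cs ≢ 0 → a ∈ endpoints cs
  count-joins-∈ a b []             ≢0 = ⊥-elim (≢0 refl)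
  count-joins-∈ a b ((p , q) ∷ cs) ≢0 with joins a b (p , q) in e
  ... | true with joins-sound a b p q e
  ...   | inj₁ (a≡p , _) = here a≡p
  ...   | inj₂ (a≡q , _) = there (here a≡q)
  count-joins-∈ a b ((p , q) ∷ cs) ≢0 | false = there (there (count-joins-∈ a b cs ≢0))

  count-joins-head : ∀ i j cs → count (joins i j) ((i , j) ∷ cs) ≢ 0
  count-joins-head i j cs rewrite ==-refl i | ==-refl j = λ ()

  FirstsAbove⇒endpointsAbove : ∀ {k} b (v : Vec (Chord m) k) → FirstsAbove b v → All Oriented (V.toList v) →
    All (λ z → b <ᵇ z ≡ true) (endpoints (V.toList v))
  FirstsAbove⇒endpointsAbove b []             _              _            = []
  FirstsAbove⇒endpointsAbove b ((p , q) ∷ cs) (b<p , above) (p<q ∷ ori) =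
    b<p ∷ <ᵇ-trans b p q b<p p<q ∷ All.map (λ {z} → <ᵇ-trans b p z b<p) (FirstsAbove⇒endpointsAbove p cs above ori)

  module _ {k} {i j : Fin m} {v : Vec (Chord m) k} (pf-v : IsPfaffForm ((i , j) ∷ v)) where
    open IsPfaffForm pf-v

    IsPfaffForm-tail : IsPfaffForm v
    IsPfaffForm-tail = record
      { matching   = tail-matching matching
      ; increasing = increasing-tail v increasing
      ; oriented   = All.tail oriented
      }
      where
        tail-matching : ∀ {xs} → Unique (i ∷ j ∷ xs) → Unique xs
        tail-matching (_ ∷ _ ∷ u) = u
        increasing-tail : ∀ {k} (v : Vec (Chord m) k) → FirstsAbove i v → FirstsIncreasing v
        increasing-tail []      _         = tt
        increasing-tail (_ ∷ _) (_ , inc) = inc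

    above-head : All (λ z → i <ᵇ z ≡ true) (endpoints (V.toList v))
    above-head = FirstsAbove⇒endpointsAbove i v increasing (All.tail oriented)

    head-minimal : ∀ {z} → z ∈ endpoints (V.toList ((i , j) ∷ v)) → z ≡ i ⊎ i <ᵇ z ≡ true
    head-minimal (here z≡i)          = inj₁ z≡i
    head-minimal (there (here refl)) = inj₂ (All.head oriented)
    head-minimal (there (there z∈))  = inj₂ (All.lookup above-head z∈)

  SameGenerators-tail : ∀ c μ ν → SameGenerators (c ∷ μ) (c ∷ ν) → SameGenerators μ ν
  SameGenerators-tail c μ ν same = sameGenerators counts-tail
    where
      counts-tail : ∀ i j → count (joins i j) μ ≡ count (joins i j) ν
      counts-tail i j with joins i j c | counts same i j
      ... | true  | e = suc-injective e
      ... | false | e = e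

  module _ {k} {i j i′ j′ : Fin m} {v w : Vec (Chord m) k}
           (pf-v : IsPfaffForm ((i , j) ∷ v)) (pf-w : IsPfaffForm ((i′ , j′) ∷ w))
           (same : SameGenerators ((i , j) ∷ V.toList v) ((i′ , j′) ∷ V.toList w)) where

    pfaffForm-heads : i ≡ i′
    pfaffForm-heads
      with head-minimal pf-w (count-joins-∈ i j _ (count-joins-head i j (V.toList v) ∘ trans (counts same i j)))
         | head-minimal pf-v (count-joins-∈ i′ j′ _ (count-joins-head i′ j′ (V.toList w) ∘ trans (sym (counts same i′ j′))))
    ... | inj₁ i≡i′ | _         = i≡i′
    ... | inj₂ _    | inj₁ i′≡i = sym i′≡i
    ... | inj₂ i′<i | inj₂ i<i′ = ⊥-elim (<ᵇ-asym i′ i i′<i i<i′)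

    pfaffForm-partners : i ≡ i′ → j ≡ j′
    pfaffForm-partners refl with joins i j (i , j′) in e
    ... | true with joins-sound i j i j′ e
    ...   | inj₁ (_ , j≡j′)   = j≡j′
    ...   | inj₂ (i≡j′ , j≡i) = ⊥-elim (<ᵇ-irrefl i (subst (λ z → i <ᵇ z ≡ true) j≡i (All.head (IsPfaffForm.oriented pf-v))))
    pfaffForm-partners refl | false =
      ⊥-elim (<ᵇ-irrefl i (All.lookup (above-head pf-w)
        (count-joins-∈ i j (V.toList w) (count-joins-head i j (V.toList v) ∘ trans (counts same i j) ∘ drop-head))))
      where
        drop-head : count (joins i j) (V.toList w) ≡ 0 → count (joins i j) ((i , j′) ∷ V.toList w) ≡ 0
        drop-head z rewrite e = z

  pfaffForm-unique : ∀ {k} (v w : Vec (Chord m) k) → IsPfaffForm v → IsPfaffForm w →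
    SameGenerators (V.toList v) (V.toList w) → v ≡ w
  pfaffForm-unique []             []              _    _    _    = refl
  pfaffForm-unique ((i , j) ∷ v) ((i′ , j′) ∷ w) pf-v pf-w same
    with pfaffForm-heads pf-v pf-w same
  ... | refl with pfaffForm-partners pf-v pf-w same refl
  ... | refl = cong ((i , j) ∷_)
    (pfaffForm-unique v w (IsPfaffForm-tail pf-v) (IsPfaffForm-tail pf-w) (SameGenerators-tail (i , j) (V.toList v) (V.toList w) same))

  length-filter-<≡count : ∀ (j : Fin m) xs → length (filter (F._<? j) xs) ≡ count (_<ᵇ j) xs
  length-filter-<≡count j []       = refl
  length-filter-<≡count j (x ∷ xs) with x <ᵇ j
  ... | true  = cong suc (length-filter-<≡count j xs)
  ... | false = length-filter-<≡count j xs

  count-<-below : ∀ (i : Fin m) xs → All (λ z → i <ᵇ z ≡ true) xs → count (_<ᵇ i) xs ≡ 0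
  count-<-below i []       []         = refl
  count-<-below i (x ∷ xs) (i<x ∷ above) with x <ᵇ i in x<i
  ... | false = count-<-below i xs above
  ... | true  = ⊥-elim (<ᵇ-asym i x i<x x<i)

  crosses-from-left : ∀ {i j p q : Fin m} → Distinct₄ i j p q → i <ᵇ p ≡ true → i <ᵇ q ≡ true →
    crosses (i , j) (p , q) ≡ p <ᵇ j xor q <ᵇ j
  crosses-from-left {i} {j} {p} {q} d i<p i<q
    rewrite crosses≡separates d | <ᵇ-flip i p (Distinct₄.ap d) | i<p | <ᵇ-flip i q (Distinct₄.aq d) | i<q =
    cong (_xor q <ᵇ j) (xor-identityʳ (p <ᵇ j))

  odd-count-< : ∀ (i j : Fin m) cs → All (Disjoint (i , j)) cs → All (λ z → i <ᵇ z ≡ true) (endpoints cs) →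
    odd (count (_<ᵇ j) (endpoints cs)) ≡ xorMap (crosses (i , j)) cs
  odd-count-< i j []             _        _                  = refl
  odd-count-< i j ((p , q) ∷ cs) (d ∷ ds) (i<p ∷ i<q ∷ above)
    rewrite odd-count (_<ᵇ j) p (q ∷ endpoints cs) | odd-count (_<ᵇ j) q (endpoints cs)
          | crosses-from-left d i<p i<q | odd-count-< i j cs ds above =
    sym (xor-assoc (p <ᵇ j) (q <ᵇ j) _)

  inversions-pfaffForm : ∀ {k} (v : Vec (Chord m) k) → IsPfaffForm v →
    odd (inversions (endpoints (V.toList v))) ≡ crossingParity (V.toList v)
  inversions-pfaffForm []             _    = refl
  inversions-pfaffForm ((i , j) ∷ cs) pf-v@record { matching = (i≢j ∷ i∉) ∷ j∉ ∷ u } = begin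
    odd (length (filter (F._<? i) (j ∷ es)) ℕ.+ (length (filter (F._<? j) es) ℕ.+ inversions es))
      ≡⟨ odd-+ (length (filter (F._<? i) (j ∷ es))) _ ⟩
    odd (length (filter (F._<? i) (j ∷ es))) xor odd (length (filter (F._<? j) es) ℕ.+ inversions es)
      ≡⟨ cong₂ (λ a b → odd a xor b) nothing-below-i (odd-+ (length (filter (F._<? j) es)) _) ⟩
    odd (length (filter (F._<? j) es)) xor odd (inversions es)
      ≡⟨ cong₂ _xor_ below-j-counts-crossings (inversions-pfaffForm cs (IsPfaffForm-tail pf-v)) ⟩
    xorMap (crosses (i , j)) (V.toList cs) xor crossingParity (V.toList cs) ∎
    where
      open ≡-Reasoning
      es = endpoints (V.toList cs)
      nothing-below-i : length (filter (F._<? i) (j ∷ es)) ≡ 0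
      nothing-below-i = trans (length-filter-<≡count i (j ∷ es))
                              (count-<-below i (j ∷ es) (All.head (IsPfaffForm.oriented pf-v) ∷ above-head pf-v))
      below-j-counts-crossings : odd (length (filter (F._<? j) es)) ≡ xorMap (crosses (i , j)) (V.toList cs)
      below-j-counts-crossings = trans (cong odd (length-filter-<≡count j es))
                                       (odd-count-< i j (V.toList cs) (Disjoint-all (V.toList cs) i≢j i∉ j∉ u) (above-head pf-v))

mapChord : ∀ {m} → (Fin m → Fin m) → Chord m → Chord m
mapChord f c = (f (proj₁ c) , f (proj₂ c))

module _ {m : ℕ} where

  PreservesCrossings : (Fin m → Fin m) → Set
  PreservesCrossings f = ∀ x y → Disjoint x y → crosses (mapChord f x) (mapChord f y) ≡ crosses x y

  endpoints-map : ∀ (f : Fin m → Fin m) cs → endpoints (map (mapChord f) cs) ≡ map f (endpoints cs)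
  endpoints-map f []             = refl
  endpoints-map f ((a , b) ∷ cs) = cong (λ es → f a ∷ f b ∷ es) (endpoints-map f cs)

  IsMatching-map : ∀ {f : Fin m → Fin m} → Injective _≡_ _≡_ f → ∀ {cs} → IsMatching cs → IsMatching (map (mapChord f) cs)
  IsMatching-map {f} f-inj {cs} u = subst Unique (sym (endpoints-map f cs)) (Unique.map⁺ f-inj u)

  ==-injective : ∀ {f : Fin m → Fin m} → Injective _≡_ _≡_ f → ∀ i k → f i == f k ≡ i == k
  ==-injective {f} f-inj i k with i == k in i=k
  ... | true = subst (λ z → f i == f z ≡ true) (==-sound i=k) (==-refl (f i))
  ... | false = ==-false λ fi≡fk → true≢false (trans (sym (==-refl i)) (subst (λ z → i == z ≡ false) (sym (f-inj fi≡fk)) i=k))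

  joins-map : ∀ {f : Fin m → Fin m} → Injective _≡_ _≡_ f → ∀ i j c → joins (f i) (f j) (mapChord f c) ≡ joins i j c
  joins-map f-inj i j (k , l)
    rewrite ==-injective f-inj i k | ==-injective f-inj j l | ==-injective f-inj i l | ==-injective f-inj j k = refl

  ⟨$⟩ʳ-injective : ∀ (π : Permutation′ m) → Injective _≡_ _≡_ (π ⟨$⟩ʳ_)
  ⟨$⟩ʳ-injective π {x} {y} πx≡πy = trans (sym (inverseˡ π)) (trans (cong (π ⟨$⟩ˡ_) πx≡πy) (inverseˡ π))

  Disjoint-map : ∀ {f : Fin m → Fin m} → Injective _≡_ _≡_ f → ∀ {x y} → Disjoint x y → Disjoint (mapChord f x) (mapChord f y)
  Disjoint-map f-inj d = record
    { ab = ab ∘ f-inj ; ap = ap ∘ f-inj ; aq = aq ∘ f-inj ; bp = bp ∘ f-inj ; bq = bq ∘ f-inj ; pq = pq ∘ f-inj }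
    where open Distinct₄ d

  PreservesCrossings-flip : ∀ (π : Permutation′ m) → PreservesCrossings (π ⟨$⟩ʳ_) → PreservesCrossings (flip π ⟨$⟩ʳ_)
  PreservesCrossings-flip π π-cross x y d =
    trans (sym (π-cross (mapChord (π ⟨$⟩ˡ_) x) (mapChord (π ⟨$⟩ˡ_) y) (Disjoint-map (⟨$⟩ʳ-injective (flip π)) d)))
          (cong₂ crosses (cancel x) (cancel y))
    where
      cancel : ∀ c → mapChord (π ⟨$⟩ʳ_) (mapChord (π ⟨$⟩ˡ_) c) ≡ c
      cancel c = cong₂ _,_ (inverseʳ π) (inverseʳ π)

  relabel : Permutation′ m → List (Chord m) → List (Chord m)
  relabel π = map (mapChord (π ⟨$⟩ʳ_))

  relabel-flip : ∀ (π : Permutation′ m) μ → relabel (flip π) (relabel π μ) ≡ μ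
  relabel-flip π μ = trans (sym (map-∘ μ)) (trans (map-cong (λ c → cong₂ _,_ (inverseˡ π) (inverseˡ π)) μ) (map-id μ))

  flip-relabel : ∀ (π : Permutation′ m) μ → relabel π (relabel (flip π) μ) ≡ μ
  flip-relabel π μ = trans (sym (map-∘ μ)) (trans (map-cong (λ c → cong₂ _,_ (inverseʳ π) (inverseʳ π)) μ) (map-id μ))

  SameGenerators-relabel : ∀ (π : Permutation′ m) {μ ν} → SameGenerators μ ν → SameGenerators (relabel π μ) (relabel π ν)
  SameGenerators-relabel π {μ} {ν} same = sameGenerators λ i j →
    subst₂ (λ a b → count (joins a b) (relabel π μ) ≡ count (joins a b) (relabel π ν)) (inverseʳ π) (inverseʳ π)
      (trans (count-joins-relabel μ) (trans (counts same (π ⟨$⟩ˡ i) (π ⟨$⟩ˡ j)) (sym (count-joins-relabel ν))))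
    where
      count-joins-relabel : ∀ {a b} κ → count (joins (π ⟨$⟩ʳ a) (π ⟨$⟩ʳ b)) (relabel π κ) ≡ count (joins a b) κ
      count-joins-relabel = count-map _ _ (mapChord (π ⟨$⟩ʳ_)) (joins-map (⟨$⟩ʳ-injective π) _ _)

-- Coefficients of the Pfaffian

module Coefficients {c ℓ} (K : CommutativeRing c ℓ) where
  open CommutativeRing K
    using (Carrier; _≈_; _+_; 0#; +-cong; +-congˡ; +-identityˡ; +-identityʳ; +-assoc; setoid; reflexive)
    renaming (refl to ≈-refl; sym to ≈-sym; trans to ≈-trans)
  open import Relation.Binary.Reasoning.Setoid setoid

  sum : ∀ {A : Set} → (A → Carrier) → List A → Carrier
  sum g = foldr (λ x r → g x + r) 0#

  sum-cong : ∀ {A : Set} {g h : A → Carrier} → (∀ x → g x ≈ h x) → ∀ xs → sum g xs ≈ sum h xs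
  sum-cong g≈h []       = ≈-refl
  sum-cong g≈h (x ∷ xs) = +-cong (g≈h x) (sum-cong g≈h xs)

  sum-zero-All : ∀ {A : Set} {g : A → Carrier} {xs} → All (λ x → g x ≈ 0#) xs → sum g xs ≈ 0#
  sum-zero-All []           = ≈-refl
  sum-zero-All (g≈0 ∷ rest) = ≈-trans (+-cong g≈0 (sum-zero-All rest)) (+-identityʳ 0#)

  sum-zero : ∀ {A : Set} {g : A → Carrier} → (∀ x → g x ≈ 0#) → ∀ xs → sum g xs ≈ 0#
  sum-zero g≈0 xs = sum-zero-All (All.tabulate {xs = xs} (λ {x} _ → g≈0 x))

  sum-++ : ∀ {A : Set} (g : A → Carrier) xs ys → sum g (xs ++ ys) ≈ sum g xs + sum g ys
  sum-++ g []       ys = ≈-sym (+-identityˡ _)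
  sum-++ g (x ∷ xs) ys = ≈-trans (+-congˡ (sum-++ g xs ys)) (≈-sym (+-assoc _ _ _))

  sum-map : ∀ {A B : Set} (g : B → Carrier) (f : A → B) xs → sum g (map f xs) ≡ sum (g ∘ f) xs
  sum-map g f []       = refl
  sum-map g f (x ∷ xs) = cong (g (f x) +_) (sum-map g f xs)

  sum-concatMap : ∀ {A B : Set} (g : B → Carrier) (f : A → List B) xs →
    sum g (concatMap f xs) ≈ sum (λ x → sum g (f x)) xs
  sum-concatMap g f []       = ≈-refl
  sum-concatMap g f (x ∷ xs) = ≈-trans (sum-++ g (f x) (concatMap f xs)) (+-congˡ (sum-concatMap g f xs))

  sum-filter : ∀ {A : Set} (g : A → Carrier) (b : A → Bool) xs →
    sum g (filter (λ x → b x B.≟ true) xs) ≈ sum (λ x → if b x then g x else 0#) xs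
  sum-filter g b []       = ≈-refl
  sum-filter g b (x ∷ xs) with b x
  ... | true  = +-congˡ (sum-filter g b xs)
  ... | false = ≈-trans (sum-filter g b xs) (≈-sym (+-identityˡ _))

  -- Every element occurs exactly once in the list, expressed through sums.
  Enumerates : ∀ {A : Set} → List A → Set _
  Enumerates {A} xs = ∀ (g : A → Carrier) w → (∀ x → x ≢ w → g x ≈ 0#) → sum g xs ≈ g w

  Unique⇒Enumerates : ∀ {A : Set} (xs : List A) → Unique xs → (∀ x → x ∈ xs) → Enumerates xs
  Unique⇒Enumerates xs u complete g w off = go xs u (complete w)
    where
      go : ∀ xs → Unique xs → w ∈ xs → sum g xs ≈ g w
      go (x ∷ xs) (fresh ∷ u) (here refl) =
        ≈-trans (+-congˡ (sum-zero-All (All.map (λ x≢y → off _ (x≢y ∘ sym)) fresh))) (+-identityʳ _)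
      go (x ∷ xs) (fresh ∷ u) (there w∈) =
        ≈-trans (+-cong (off x λ { refl → All.lookup fresh w∈ refl }) (go xs u w∈)) (+-identityˡ _)

  Enumerates-concatMap : ∀ {A B C : Set} {xs : List A} {ys : List B} (h : A → B → C) (split : C → A × B) →
    (∀ z → uncurry h (split z) ≡ z) → (∀ a b → split (h a b) ≡ (a , b)) →
    Enumerates xs → Enumerates ys → Enumerates (concatMap (λ a → map (h a) ys) xs)
  Enumerates-concatMap {xs = xs} {ys} h split h∘split split∘h enum-xs enum-ys g w off = begin
    sum g (concatMap (λ a → map (h a) ys) xs)  ≈⟨ sum-concatMap g _ xs ⟩
    sum (λ a → sum g (map (h a) ys)) xs         ≈⟨ sum-cong (λ a → reflexive (sum-map g (h a) ys)) xs ⟩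
    sum (λ a → sum (g ∘ h a) ys) xs             ≈⟨ enum-xs _ a₀ outside-row ⟩
    sum (g ∘ h a₀) ys                           ≈⟨ enum-ys (g ∘ h a₀) b₀ outside-column ⟩
    g (h a₀ b₀)                                 ≡⟨ cong g (h∘split w) ⟩
    g w                                         ∎
    where
      a₀ = proj₁ (split w)
      b₀ = proj₂ (split w)
      hits : ∀ {a b} → h a b ≡ w → (a , b) ≡ split w
      hits {a} {b} hab≡w = trans (sym (split∘h a b)) (cong split hab≡w)
      outside-row : ∀ a → a ≢ a₀ → sum (g ∘ h a) ys ≈ 0#
      outside-row a a≢a₀ = sum-zero (λ b → off (h a b) (λ e → a≢a₀ (cong proj₁ (hits e)))) ys
      outside-column : ∀ b → b ≢ b₀ → g (h a₀ b) ≈ 0#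
      outside-column b b≢b₀ = off (h a₀ b) (λ e → b≢b₀ (cong proj₂ (hits e)))

  Enumerates-allFin : ∀ m → Enumerates (allFin m)
  Enumerates-allFin m = Unique⇒Enumerates (allFin m) (allFin⁺ m) ∈-allFin

  Enumerates-chords : ∀ m → Enumerates (concatMap (λ i → map (i ,_) (allFin m)) (allFin m))
  Enumerates-chords m =
    Enumerates-concatMap {xs = allFin m} {ys = allFin m} (λ a b → (a , b)) (λ c → c) (λ _ → refl) (λ _ _ → refl)
      (Enumerates-allFin m) (Enumerates-allFin m)

  Enumerates-vecsOf : ∀ {A : Set} {xs : List A} → Enumerates xs → ∀ k → Enumerates (vecsOf xs k)
  Enumerates-vecsOf enum zero    g [] off = +-identityʳ (g [])
  Enumerates-vecsOf {xs = xs} enum (suc k) =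
    Enumerates-concatMap {xs = xs} {ys = vecsOf xs k} (λ x v → x ∷ v) (λ v → V.head v , V.tail v)
      (λ { (_ ∷ _) → refl }) (λ _ _ → refl) enum (Enumerates-vecsOf enum k)

  module _ (m : ℕ) where
    open Poly K m

    expo≡count : ∀ μ i j → expo μ i j ≡ count (joins i j) μ
    expo≡count μ i j = length-filter≡count (isGen i j) μ

    sameMonomial-sound : ∀ μ ν → sameMonomial μ ν ≡ true → SameGenerators μ ν
    sameMonomial-sound μ ν e = sameGenerators λ i j →
      subst₂ _≡_ (expo≡count μ i j) (expo≡count ν i j)
        (≡ᵇ⇒≡ _ _ (Equivalence.from T-≡
          (All.lookup (allB-sound _ (allFin m) (All.lookup (allB-sound _ (allFin m) e) (∈-allFin i))) (∈-allFin j))))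

    sameMonomial-complete : ∀ μ ν → SameGenerators μ ν → sameMonomial μ ν ≡ true
    sameMonomial-complete μ ν same =
      allB-complete _ (allFin m) (All.tabulate λ {i} _ → allB-complete _ (allFin m) (All.tabulate λ {j} _ →
        Equivalence.to T-≡ (≡⇒≡ᵇ _ _ (subst₂ _≡_ (sym (expo≡count μ i j)) (sym (expo≡count ν i j)) (counts same i j)))))

    sameMonomial-cong : ∀ {μ μ′ : Monomial} → SameGenerators μ μ′ → ∀ ν → sameMonomial μ ν ≡ sameMonomial μ′ ν
    sameMonomial-cong {μ} {μ′} same ν = Bool-ext
      (λ e → sameMonomial-complete μ′ ν (SameGenerators-trans (SameGenerators-sym same) (sameMonomial-sound μ ν e)))
      (λ e → sameMonomial-complete μ ν (SameGenerators-trans same (sameMonomial-sound μ′ ν e)))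

    coeff-cong : ∀ {μ μ′ : Monomial} → SameGenerators μ μ′ → ∀ P → coeff μ P ≡ coeff μ′ P
    coeff-cong same []            = refl
    coeff-cong same ((a , ν) ∷ P) =
      cong₂ _+_ (cong (λ b → if b then a else 0#) (sameMonomial-cong same ν)) (coeff-cong same P)

    sameMonomial-act : ∀ σ μ ν → sameMonomial μ (actMon σ ν) ≡ sameMonomial (relabel σ μ) ν
    sameMonomial-act σ μ ν = Bool-ext
      (λ e → sameMonomial-complete (relabel σ μ) ν
        (subst (SameGenerators (relabel σ μ)) (flip-relabel σ ν) (SameGenerators-relabel σ (sameMonomial-sound μ (actMon σ ν) e))))
      (λ e → sameMonomial-complete μ (actMon σ ν)
        (subst (λ κ → SameGenerators κ (actMon σ ν)) (relabel-flip σ μ)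
          (SameGenerators-relabel (flip σ) (sameMonomial-sound (relabel σ μ) ν e))))

    coeff-act : ∀ σ μ P → coeff μ (act σ P) ≡ coeff (relabel σ μ) P
    coeff-act σ μ []            = refl
    coeff-act σ μ ((a , ν) ∷ P) =
      cong₂ _+_ (cong (λ b → if b then a else 0#) (sameMonomial-act σ μ ν)) (coeff-act σ μ P)

module PfaffianCoefficients {c ℓ} (K : CommutativeRing c ℓ) (n : ℕ) where
  open CommutativeRing K
    using (Carrier; _≈_; _+_; 0#; 1#; -_; +-congˡ; -‿inverseʳ; setoid; reflexive)
    renaming (refl to ≈-refl; sym to ≈-sym; trans to ≈-trans)
  open import Relation.Binary.Reasoning.Setoid setoid
  open Poly K (2 * n)
  open Coefficients K

  PfaffVec : Set
  PfaffVec = Vec (Chord (2 * n)) n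

  candidates : List PfaffVec
  candidates = vecsOf (concatMap (λ i → map (i ,_) (allFin (2 * n))) (allFin (2 * n))) n

  term : Monomial → PfaffVec → Carrier
  term μ v = if isPfaff v then (if sameMonomial μ (V.toList v) then signK (inversions (oneLine v)) else 0#) else 0#

  coeff-map : ∀ μ (vs : List PfaffVec) →
    coeff μ (map (λ v → (signK (inversions (oneLine v)) , V.toList v)) vs) ≡
    sum (λ v → if sameMonomial μ (V.toList v) then signK (inversions (oneLine v)) else 0#) vs
  coeff-map μ []       = refl
  coeff-map μ (v ∷ vs) = cong (_ +_) (coeff-map μ vs)

  coeff-pf : ∀ μ → coeff μ (pf K n) ≈ sum (term μ) candidates
  coeff-pf μ = ≈-trans (reflexive (coeff-map μ (PfaffPerms n))) (sum-filter _ isPfaff candidates)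

  sign : Bool → Carrier
  sign b = if b then - 1# else 1#

  sign-pfaffForm : ∀ (v : PfaffVec) → IsPfaffForm v → signK (inversions (oneLine v)) ≡ sign (crossingParity (V.toList v))
  sign-pfaffForm v pf-v rewrite oneLine≡endpoints v | sym (inversions-pfaffForm v pf-v)
    with isEven (inversions (endpoints (V.toList v)))
  ... | true  = refl
  ... | false = refl

  coeff-pf-matching : ∀ (L : PfaffVec) → IsMatching (V.toList L) → coeff (V.toList L) (pf K n) ≈ sign (crossingParity (V.toList L))
  coeff-pf-matching L u = begin
    coeff (V.toList L) (pf K n)                     ≈⟨ coeff-pf (V.toList L) ⟩
    sum (term (V.toList L)) candidates              ≈⟨ Enumerates-vecsOf (Enumerates-chords (2 * n)) n _ w off-w ⟩
    term (V.toList L) w                             ≡⟨ at-w ⟩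
    signK (inversions (oneLine w))                  ≡⟨ sign-pfaffForm w pf-w ⟩
    sign (crossingParity (V.toList w))              ≡⟨ cong sign (pfaffForm-crossingParity L u) ⟩
    sign (crossingParity (V.toList L))              ∎
    where
      w = pfaffForm L
      pf-w = pfaffForm-isPfaffForm L u
      L~w : SameGenerators (V.toList L) (V.toList w)
      L~w = SameGenerators-sym (pfaffForm-sameGenerators L)
      at-w : term (V.toList L) w ≡ signK (inversions (oneLine w))
      at-w rewrite isPfaff-complete w pf-w | sameMonomial-complete (2 * n) (V.toList L) (V.toList w) L~w = refl
      off-w : ∀ v → v ≢ w → term (V.toList L) v ≈ 0#
      off-w v v≢w with isPfaff v in pf-v
      ... | false = ≈-refl
      ... | true with sameMonomial (V.toList L) (V.toList v) in L~v
      ...   | false = ≈-refl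
      ...   | true  = ⊥-elim (v≢w (pfaffForm-unique v w (isPfaff-sound v pf-v) pf-w
                        (SameGenerators-trans (SameGenerators-sym (sameMonomial-sound (2 * n) (V.toList L) (V.toList v) L~v)) L~w)))

  coeff-pf-classify : ∀ μ → (Σ PfaffVec λ v → IsPfaffForm v × SameGenerators μ (V.toList v)) ⊎ coeff μ (pf K n) ≈ 0#
  coeff-pf-classify μ with any? (λ v → (isPfaff v ∧ sameMonomial μ (V.toList v)) B.≟ true) candidates
  ... | yes found with satisfied found
  ...   | v , e = inj₁ (v , isPfaff-sound v (proj₁ (∧-true e)) , sameMonomial-sound (2 * n) μ (V.toList v) (proj₂ (∧-true e)))
  coeff-pf-classify μ | no none =
    inj₂ (≈-trans (coeff-pf μ) (sum-zero-All (All.map (λ {v} → vanishes {v}) (¬Any⇒All¬ candidates none))))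
    where
      vanishes : ∀ {v} → (isPfaff v ∧ sameMonomial μ (V.toList v)) ≢ true → term μ v ≈ 0#
      vanishes {v} ≢true with isPfaff v
      ... | false = ≈-refl
      ... | true with sameMonomial μ (V.toList v)
      ...   | false = ≈-refl
      ...   | true  = ⊥-elim (≢true refl)

  coeff-pf-relabelled : ∀ (π : Permutation′ (2 * n)) (v : PfaffVec) → IsMatching (V.toList v) →
    coeff (relabel π (V.toList v)) (pf K n) ≈ sign (crossingParity (relabel π (V.toList v)))
  coeff-pf-relabelled π v u =
    subst (λ cs → coeff cs (pf K n) ≈ sign (crossingParity cs)) (toList-map (mapChord (π ⟨$⟩ʳ_)) v)
      (coeff-pf-matching (V.map (mapChord (π ⟨$⟩ʳ_)) v)
        (subst IsMatching (sym (toList-map (mapChord (π ⟨$⟩ʳ_)) v)) (IsMatching-map (⟨$⟩ʳ-injective π) u)))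

  coeff-pf-relabel-matching : ∀ (π : Permutation′ (2 * n)) → PreservesCrossings (π ⟨$⟩ʳ_) →
    ∀ μ (v : PfaffVec) → IsPfaffForm v → SameGenerators μ (V.toList v) →
    coeff (relabel π μ) (pf K n) ≈ coeff μ (pf K n)
  coeff-pf-relabel-matching π π-cross μ v pf-v μ~v = begin
    coeff (relabel π μ) (pf K n)                     ≡⟨ coeff-cong (2 * n) (SameGenerators-relabel π μ~v) (pf K n) ⟩
    coeff (relabel π (V.toList v)) (pf K n)          ≈⟨ coeff-pf-relabelled π v u ⟩
    sign (crossingParity (relabel π (V.toList v)))   ≡⟨ cong sign (crossingParity-map _ π-cross (V.toList v) u) ⟩
    sign (crossingParity (V.toList v))               ≈⟨ ≈-sym (coeff-pf-matching v u) ⟩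
    coeff (V.toList v) (pf K n)                      ≡⟨ coeff-cong (2 * n) (SameGenerators-sym μ~v) (pf K n) ⟩
    coeff μ (pf K n)                                 ∎
    where u = IsPfaffForm.matching pf-v

  coeff-pf-relabel : ∀ (π : Permutation′ (2 * n)) → PreservesCrossings (π ⟨$⟩ʳ_) →
    ∀ μ → coeff (relabel π μ) (pf K n) ≈ coeff μ (pf K n)
  coeff-pf-relabel π π-cross μ with coeff-pf-classify μ
  ... | inj₁ (v , pf-v , μ~v) = coeff-pf-relabel-matching π π-cross μ v pf-v μ~v
  ... | inj₂ μ↦0 with coeff-pf-classify (relabel π μ)
  ...   | inj₁ (w , pf-w , πμ~w) = begin
    coeff (relabel π μ) (pf K n)
      ≈⟨ ≈-sym (coeff-pf-relabel-matching (flip π) (PreservesCrossings-flip π π-cross) (relabel π μ) w pf-w πμ~w) ⟩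
    coeff (relabel (flip π) (relabel π μ)) (pf K n)        ≡⟨ cong (λ κ → coeff κ (pf K n)) (relabel-flip π μ) ⟩
    coeff μ (pf K n)                                       ∎
  ...   | inj₂ πμ↦0 = ≈-trans πμ↦0 (≈-sym μ↦0)

  sign-injective : ¬ (1# + 1# ≈ 0#) → ∀ {a b} → sign a ≈ sign b → a ≡ b
  sign-injective 1+1≉0 {true}  {true}  _ = refl
  sign-injective 1+1≉0 {false} {false} _ = refl
  sign-injective 1+1≉0 {true}  {false} e = ⊥-elim (1+1≉0 (≈-trans (+-congˡ (≈-sym e)) (-‿inverseʳ 1#)))
  sign-injective 1+1≉0 {false} {true}  e = ⊥-elim (1+1≉0 (≈-trans (+-congˡ e) (-‿inverseʳ 1#)))

  fixes-pf⇒crossingParity : ¬ (1# + 1# ≈ 0#) → ∀ (σ : Permutation′ (2 * n)) → act σ (pf K n) ≈ₚ pf K n →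
    ∀ (v : PfaffVec) → IsMatching (V.toList v) → crossingParity (relabel σ (V.toList v)) ≡ crossingParity (V.toList v)
  fixes-pf⇒crossingParity 1+1≉0 σ σpf≈pf v u = sign-injective 1+1≉0 (begin
    sign (crossingParity (relabel σ (V.toList v)))   ≈⟨ ≈-sym (coeff-pf-relabelled σ v u) ⟩
    coeff (relabel σ (V.toList v)) (pf K n)          ≡⟨ sym (coeff-act (2 * n) σ (V.toList v) (pf K n)) ⟩
    coeff (V.toList v) (act σ (pf K n))              ≈⟨ σpf≈pf (V.toList v) ⟩
    coeff (V.toList v) (pf K n)                      ≈⟨ coeff-pf-matching v u ⟩
    sign (crossingParity (V.toList v))               ∎)

-- Dihedral symmetries preserve crossings

wrap : ℕ → Bool → ℕ
wrap m true  = m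
wrap m false = 0

module _ where
  open import Data.Nat using (_+_; _≤?_)
  open import Data.Nat.Properties

  <ᵇ-cong : ∀ {a b c d} → (a < b → c < d) → (c < d → a < b) → (a ℕ.<ᵇ b) ≡ (c ℕ.<ᵇ d)
  <ᵇ-cong {a} {b} {c} {d} f g with a ℕ.<ᵇ b in e₁ | c ℕ.<ᵇ d in e₂
  ... | true  | true  = refl
  ... | false | false = refl
  ... | true  | false = ⊥-elim (<-irrefl refl (<-≤-trans (f (<ᵇ-sound e₁)) (≮ᵇ-sound e₂)))
  ... | false | true  = ⊥-elim (<-irrefl refl (<-≤-trans (g (<ᵇ-sound e₂)) (≮ᵇ-sound e₁)))

  +-reverses-< : ∀ {a b c d} → a + b ≡ c + d → a < c → d < b
  +-reverses-< {a} {b} {c} {d} e a<c with b ≤? d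
  ... | yes b≤d = ⊥-elim (<-irrefl e (+-mono-<-≤ a<c b≤d))
  ... | no  b≰d = ≰⇒> b≰d

  <ᵇ-antitone : ∀ a b c d → a + b ≡ c + d → (a ℕ.<ᵇ c) ≡ (d ℕ.<ᵇ b)
  <ᵇ-antitone a b c d e =
    <ᵇ-cong {a} {c} {d} {b} (+-reverses-< {a} {b} {c} {d} e)
            (+-reverses-< {d} {c} {b} {a} (trans (+-comm d c) (trans (sym e) (+-comm a b))))

  -- tx, ty are the images of ax, ay under the rotation x ↦ x + k (mod m); wx, wy record wrap-around.
  <ᵇ-rotation : ∀ m tx ty ax ay k wx wy → tx + wrap m wx ≡ ax + k → ty + wrap m wy ≡ ay + k →
    tx < m → ty < m → ax < m → ay < m → (tx ℕ.<ᵇ ty) ≡ (((ax ℕ.<ᵇ ay) xor false) xor wx) xor wy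
  <ᵇ-rotation m tx ty ax ay k false false ex ey _ _ _ _ =
    trans (<ᵇ-cong (λ p → +-cancelʳ-< k ax ay (subst₂ _<_ ex′ ey′ p)) (λ p → subst₂ _<_ (sym ex′) (sym ey′) (+-monoˡ-< k p)))
          (solve 1 (λ L → L := ((L :+ con false) :+ con false) :+ con false) refl (ax ℕ.<ᵇ ay))
    where
      ex′ = trans (sym (+-identityʳ tx)) ex
      ey′ = trans (sym (+-identityʳ ty)) ey
  <ᵇ-rotation m tx ty ax ay k true true ex ey _ _ _ _ =
    trans (<ᵇ-cong (λ p → +-cancelʳ-< k ax ay (subst₂ _<_ ex ey (+-monoˡ-< m p)))
                   (λ p → +-cancelʳ-< m tx ty (subst₂ _<_ (sym ex) (sym ey) (+-monoˡ-< k p))))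
          (solve 1 (λ L → L := ((L :+ con false) :+ con true) :+ con true) refl (ax ℕ.<ᵇ ay))
  <ᵇ-rotation m tx ty ax ay k true false ex ey txm tym axm aym =
    trans (<ᵇ-complete tx<ty) (cong (λ z → ((z xor false) xor true) xor false) (sym (≮ᵇ-complete ay≤ax)))
    where
      tx<k : tx < k
      tx<k = +-cancelʳ-< m tx k (subst (_< k + m) (sym ex) (subst (ax + k <_) (+-comm m k) (+-monoˡ-< k axm)))
      tx<ty : tx < ty
      tx<ty = <-≤-trans tx<k (subst (k ≤_) (trans (+-comm k ay) (sym (trans (sym (+-identityʳ ty)) ey))) (m≤m+n k ay))
      ay≤ax : ay ≤ ax
      ay≤ax = <⇒≤ (+-cancelʳ-< k ay ax
                (subst (_< ax + k) (trans (sym (+-identityʳ ty)) ey) (<-≤-trans tym (subst (m ≤_) ex (m≤n+m m tx)))))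
  <ᵇ-rotation m tx ty ax ay k false true ex ey txm tym axm aym =
    trans (≮ᵇ-complete (<⇒≤ ty<tx)) (cong (λ z → ((z xor false) xor false) xor true) (sym (<ᵇ-complete ax<ay)))
    where
      ty<k : ty < k
      ty<k = +-cancelʳ-< m ty k (subst (_< k + m) (sym ey) (subst (ay + k <_) (+-comm m k) (+-monoˡ-< k aym)))
      ty<tx : ty < tx
      ty<tx = <-≤-trans ty<k (subst (k ≤_) (trans (+-comm k ax) (sym (trans (sym (+-identityʳ tx)) ex))) (m≤m+n k ax))
      ax<ay : ax < ay
      ax<ay = +-cancelʳ-< k ax ay (subst (_< ay + k) (trans (sym (+-identityʳ tx)) ex) (<-≤-trans txm (subst (m ≤_) ey (m≤n+m m ty))))

  -- tx, ty are the images of ax, ay under the reflection x ↦ k − x (mod m); wx, wy record wrap-around.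
  <ᵇ-reflection : ∀ m tx ty ax ay k wx wy → tx + ax ≡ k + wrap m wx → ty + ay ≡ k + wrap m wy →
    tx < m → ty < m → ax < m → ay < m → ax ≢ ay → (tx ℕ.<ᵇ ty) ≡ (((ax ℕ.<ᵇ ay) xor true) xor wx) xor wy
  <ᵇ-reflection m tx ty ax ay k false false ex ey _ _ _ _ ne =
    trans (<ᵇ-antitone tx ax ty ay (trans ex (sym ey)))
          (trans (<ᵇ-flipℕ ax ay ne) (solve 1 (λ L → con true :+ L := ((L :+ con true) :+ con false) :+ con false) refl (ax ℕ.<ᵇ ay)))
  <ᵇ-reflection m tx ty ax ay k true true ex ey _ _ _ _ ne =
    trans (<ᵇ-antitone tx ax ty ay (trans ex (sym ey)))
          (trans (<ᵇ-flipℕ ax ay ne) (solve 1 (λ L → con true :+ L := ((L :+ con true) :+ con true) :+ con true) refl (ax ℕ.<ᵇ ay)))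
  <ᵇ-reflection m tx ty ax ay k true false ex ey txm tym axm aym ne =
    trans (≮ᵇ-complete (<⇒≤ ty<tx)) (trans (sym (≮ᵇ-complete (<⇒≤ ay<ax)))
          (solve 1 (λ L → L := ((L :+ con true) :+ con true) :+ con false) refl (ax ℕ.<ᵇ ay)))
    where
      ey′ = trans ey (+-identityʳ k)
      k<tx : k < tx
      k<tx = +-cancelʳ-< m k tx (subst (_< tx + m) ex (+-monoʳ-< tx axm))
      ty<tx = ≤-<-trans (subst (ty ≤_) ey′ (m≤m+n ty ay)) k<tx
      k<ax : k < ax
      k<ax = +-cancelʳ-< m k ax (subst (_< ax + m) (trans (+-comm ax tx) ex) (+-monoʳ-< ax txm))
      ay<ax = ≤-<-trans (subst (ay ≤_) ey′ (m≤n+m ay ty)) k<ax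
  <ᵇ-reflection m tx ty ax ay k false true ex ey txm tym axm aym ne =
    trans (<ᵇ-complete tx<ty) (trans (sym (<ᵇ-complete ax<ay))
          (solve 1 (λ L → L := ((L :+ con true) :+ con false) :+ con true) refl (ax ℕ.<ᵇ ay)))
    where
      ex′ = trans ex (+-identityʳ k)
      k<ty : k < ty
      k<ty = +-cancelʳ-< m k ty (subst (_< ty + m) ey (+-monoʳ-< ty aym))
      tx<ty = ≤-<-trans (subst (tx ≤_) ex′ (m≤m+n tx ax)) k<ty
      k<ay : k < ay
      k<ay = +-cancelʳ-< m k ay (subst (_< ay + m) (trans (+-comm ay ty) ey) (+-monoʳ-< ay tym))
      ax<ay = ≤-<-trans (subst (ax ≤_) ex′ (m≤n+m ax tx)) k<ay

module _ {m : ℕ} where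

  -- Under a dihedral map, comparisons change by a global orientation flag and a
  -- wrap-around flag of each of the two points.
  record TwistedOrder (τ : Fin m → Fin m) : Set where
    field
      flipped : Bool
      wraps   : Fin m → Bool
      compare : ∀ x y → x ≢ y → τ x <ᵇ τ y ≡ ((x <ᵇ y xor flipped) xor wraps x) xor wraps y

  orientation : Fin m → Fin m → Fin m → Bool
  orientation a b c = (a <ᵇ b xor b <ᵇ c) xor a <ᵇ c

  orientation-twisted : ∀ {τ} (tw : TwistedOrder τ) {x y z} → x ≢ y → y ≢ z → x ≢ z →
    orientation (τ x) (τ y) (τ z) ≡ orientation x y z xor TwistedOrder.flipped tw
  orientation-twisted tw {x} {y} {z} x≢y y≢z x≢z
    rewrite TwistedOrder.compare tw x y x≢y | TwistedOrder.compare tw y z y≢z | TwistedOrder.compare tw x z x≢z =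
    solve 7 (λ a b c r u v w → (((((a :+ r) :+ u) :+ v) :+ (((b :+ r) :+ v) :+ w)) :+ (((c :+ r) :+ u) :+ w))
                               := ((a :+ b) :+ c) :+ r) refl
      (x <ᵇ y) (y <ᵇ z) (x <ᵇ z) (TwistedOrder.flipped tw) (TwistedOrder.wraps tw x) (TwistedOrder.wraps tw y) (TwistedOrder.wraps tw z)

  separates≡orientations : ∀ {a b p q : Fin m} → Distinct₄ a b p q →
    separates (a , b) (p , q) ≡ orientation a p b xor orientation a q b
  separates≡orientations {a} {b} {p} {q} d
    rewrite <ᵇ-flip p a (Distinct₄.ap d ∘ sym) | <ᵇ-flip q a (Distinct₄.aq d ∘ sym) =
    solve 5 (λ A B C D X → ((A :+ B) :+ C) :+ D := (((con true :+ A) :+ B) :+ X) :+ (((con true :+ C) :+ D) :+ X)) refl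
      (p <ᵇ a) (p <ᵇ b) (q <ᵇ a) (q <ᵇ b) (a <ᵇ b)

  twisted⇒PreservesCrossings : ∀ {τ} → TwistedOrder τ → Injective _≡_ _≡_ τ → PreservesCrossings τ
  twisted⇒PreservesCrossings {τ} tw τ-inj (a , b) (p , q) d = begin
    crosses (τ a , τ b) (τ p , τ q)                                  ≡⟨ crosses≡separates d′ ⟩
    separates (τ a , τ b) (τ p , τ q)                                ≡⟨ separates≡orientations d′ ⟩
    orientation (τ a) (τ p) (τ b) xor orientation (τ a) (τ q) (τ b)  ≡⟨ cong₂ _xor_ (orientation-twisted tw ap (bp ∘ sym) ab)
                                                                                    (orientation-twisted tw aq (bq ∘ sym) ab) ⟩
    (orientation a p b xor r) xor (orientation a q b xor r)          ≡⟨ solve 3 (λ x y r → (x :+ r) :+ (y :+ r) := x :+ y) refl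
                                                                          (orientation a p b) (orientation a q b) r ⟩
    orientation a p b xor orientation a q b                          ≡⟨ sym (separates≡orientations d) ⟩
    separates (a , b) (p , q)                                        ≡⟨ sym (crosses≡separates d) ⟩
    crosses (a , b) (p , q)                                          ∎
    where
      open ≡-Reasoning
      open Distinct₄ d
      r = TwistedOrder.flipped tw
      d′ : Distinct₄ (τ a) (τ b) (τ p) (τ q)
      d′ = Disjoint-map τ-inj d

module _ (m : ℕ) .{{_ : NonZero m}} where
  open import Data.Nat using (_+_; _∸_; _≤?_)
  open import Data.Nat.Properties
  open import Data.Nat.DivMod
  open import Data.Nat.Divisibility using (_∣_; divides)
  open import Data.Integer.Properties using ([+m]-[+n]≡m⊖n; ∣⊖∣-≤; ∣m⊖n∣≡∣n⊖m∣)

  ∣∸⇒%≡ : ∀ {x y} → x ≤ y → m ∣ (y ∸ x) → x % m ≡ y % m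
  ∣∸⇒%≡ {x} {y} x≤y m∣y∸x = trans (sym (%-remove-+ʳ x m∣y∸x)) (cong (_% m) (m+[n∸m]≡n x≤y))

  %≡⇒∣∸ : ∀ x y → x % m ≡ y % m → m ∣ (y ∸ x)
  %≡⇒∣∸ x y x≡y = divides (y / m ∸ x / m) (begin
    y ∸ x                                          ≡⟨ cong₂ _∸_ (m≡m%n+[m/n]*n y m) (m≡m%n+[m/n]*n x m) ⟩
    (y % m + (y / m) * m) ∸ (x % m + (x / m) * m)  ≡⟨ cong (λ r → (y % m + (y / m) * m) ∸ (r + (x / m) * m)) x≡y ⟩
    (y % m + (y / m) * m) ∸ (y % m + (x / m) * m)  ≡⟨ [m+n]∸[m+o]≡n∸o (y % m) _ _ ⟩
    (y / m) * m ∸ (x / m) * m                      ≡⟨ sym (*-distribʳ-∸ m (y / m) (x / m)) ⟩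
    (y / m ∸ x / m) * m                            ∎)
    where open ≡-Reasoning

  ℤ∣⇔%≡ : ∀ x y → (ℤ.+ m) ℤD.∣ ((ℤ.+ x) ℤ.- (ℤ.+ y)) ⇔ x % m ≡ y % m
  ℤ∣⇔%≡ x y rewrite [+m]-[+n]≡m⊖n x y with x ≤? y
  ... | yes x≤y rewrite ∣⊖∣-≤ x≤y = mk⇔ (∣∸⇒%≡ x≤y) (%≡⇒∣∸ x y)
  ... | no  x≰y rewrite ∣m⊖n∣≡∣n⊖m∣ x y | ∣⊖∣-≤ (<⇒≤ (≰⇒> x≰y)) =
    mk⇔ (sym ∘ ∣∸⇒%≡ (<⇒≤ (≰⇒> x≰y))) (%≡⇒∣∸ y x ∘ sym)

  %-wrap : ∀ s → s < m + m → s % m + wrap m (not (s ℕ.<ᵇ m)) ≡ s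
  %-wrap s s<2m with s ℕ.<ᵇ m in s<m
  ... | true  = trans (+-identityʳ _) (m<n⇒m%n≡m (<ᵇ-sound s<m))
  ... | false = trans (cong (_+ m) (trans (sym (m≤n⇒[n∸m]%m≡n%m m≤s)) (m<n⇒m%n≡m s∸m<m))) (m∸n+n≡m m≤s)
    where
      m≤s : m ≤ s
      m≤s = ≮ᵇ-sound s<m
      s∸m<m : s ∸ m < m
      s∸m<m = subst (s ∸ m <_) (m+n∸n≡m m m) (∸-monoˡ-< s<2m m≤s)

  dihedral⇒TwistedOrder : ∀ (σ : Permutation′ m) → Dihedral m σ → TwistedOrder (σ ⟨$⟩ʳ_)
  dihedral⇒TwistedOrder σ (k , inj₁ rotation) = record { flipped = false ; wraps = w ; compare = compare }
    where
      t : Fin m → ℕ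
      t x = toℕ (σ ⟨$⟩ʳ x)
      w : Fin m → Bool
      w x = not ((toℕ x + k % m) ℕ.<ᵇ m)
      t≡ : ∀ x → t x + wrap m (w x) ≡ toℕ x + k % m
      t≡ x = trans (cong (_+ wrap m (w x)) t≡%) (%-wrap (toℕ x + k % m) (+-mono-< (toℕ<n x) (m%n<n k m)))
        where
          t≡% : t x ≡ (toℕ x + k % m) % m
          t≡% = begin
            t x                           ≡⟨ sym (m<n⇒m%n≡m (toℕ<n _)) ⟩
            t x % m                       ≡⟨ Equivalence.to (ℤ∣⇔%≡ (t x) (toℕ x + k)) (rotation x) ⟩
            (toℕ x + k) % m               ≡⟨ %-distribˡ-+ (toℕ x) k m ⟩
            (toℕ x % m + k % m) % m       ≡⟨ cong (λ r → (r + k % m) % m) (m<n⇒m%n≡m (toℕ<n x)) ⟩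
            (toℕ x + k % m) % m           ∎
            where open ≡-Reasoning
      compare : ∀ x y → x ≢ y → (σ ⟨$⟩ʳ x) <ᵇ (σ ⟨$⟩ʳ y) ≡ ((x <ᵇ y xor false) xor w x) xor w y
      compare x y _ = <ᵇ-rotation m (t x) (t y) (toℕ x) (toℕ y) (k % m) (w x) (w y) (t≡ x) (t≡ y)
                        (toℕ<n _) (toℕ<n _) (toℕ<n x) (toℕ<n y)
  dihedral⇒TwistedOrder σ (k , inj₂ reflection) = record { flipped = true ; wraps = w ; compare = compare }
    where
      t : Fin m → ℕ
      t x = toℕ (σ ⟨$⟩ʳ x)
      w : Fin m → Bool
      w x = not ((t x + toℕ x) ℕ.<ᵇ m)
      t≡ : ∀ x → t x + toℕ x ≡ k % m + wrap m (w x)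
      t≡ x = sym (trans (cong (_+ wrap m (w x)) (sym (Equivalence.to (ℤ∣⇔%≡ (t x + toℕ x) k) (reflection x))))
                        (%-wrap (t x + toℕ x) (+-mono-< (toℕ<n _) (toℕ<n x))))
      compare : ∀ x y → x ≢ y → (σ ⟨$⟩ʳ x) <ᵇ (σ ⟨$⟩ʳ y) ≡ ((x <ᵇ y xor true) xor w x) xor w y
      compare x y x≢y = <ᵇ-reflection m (t x) (t y) (toℕ x) (toℕ y) (k % m) (w x) (w y) (t≡ x) (t≡ y)
                          (toℕ<n _) (toℕ<n _) (toℕ<n x) (toℕ<n y) (x≢y ∘ toℕ-injective)

-- Crossing parities determine crossings

pairUp : ∀ {A : Set} k (xs : List A) → length xs ≡ k * 2 → Vec (A × A) k
pairUp zero    []           _ = []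
pairUp (suc k) (x ∷ y ∷ xs) e = (x , y) ∷ pairUp k xs (suc-injective (suc-injective e))

module _ {m : ℕ} where

  crosses-regroup : ∀ {a b c d : Fin m} r → Disjoint (a , b) r → Disjoint (c , d) r → Disjoint (a , c) r → Disjoint (b , d) r →
    crosses (a , b) r xor crosses (c , d) r ≡ crosses (a , c) r xor crosses (b , d) r
  crosses-regroup {a} {b} {c} {d} (p , q) dab dcd dac dbd
    rewrite crosses≡separates dab | crosses≡separates dcd | crosses≡separates dac | crosses≡separates dbd =
    solve 8 (λ pa pb pc pd qa qb qc qd →
               (((pa :+ pb) :+ qa) :+ qb) :+ (((pc :+ pd) :+ qc) :+ qd) := (((pa :+ pc) :+ qa) :+ qc) :+ (((pb :+ pd) :+ qb) :+ qd))
      refl (p <ᵇ a) (p <ᵇ b) (p <ᵇ c) (p <ᵇ d) (q <ᵇ a) (q <ᵇ b) (q <ᵇ c) (q <ᵇ d)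

  xorMap-regroup : ∀ {a b c d : Fin m} R → All (Disjoint (a , b)) R → All (Disjoint (c , d)) R →
    All (Disjoint (a , c)) R → All (Disjoint (b , d)) R →
    xorMap (crosses (a , b)) R xor xorMap (crosses (c , d)) R ≡ xorMap (crosses (a , c)) R xor xorMap (crosses (b , d)) R
  xorMap-regroup []       []           []           []           []           = refl
  xorMap-regroup {a} {b} {c} {d} (r ∷ R) (dab ∷ dabs) (dcd ∷ dcds) (dac ∷ dacs) (dbd ∷ dbds) = begin
    (crosses (a , b) r xor X) xor (crosses (c , d) r xor Y)  ≡⟨ swap-middle (crosses (a , b) r) X (crosses (c , d) r) Y ⟩
    (crosses (a , b) r xor crosses (c , d) r) xor (X xor Y)  ≡⟨ cong₂ _xor_ (crosses-regroup r dab dcd dac dbd)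
                                                                             (xorMap-regroup R dabs dcds dacs dbds) ⟩
    (crosses (a , c) r xor crosses (b , d) r) xor (Z xor W)  ≡⟨ sym (swap-middle (crosses (a , c) r) Z (crosses (b , d) r) W) ⟩
    (crosses (a , c) r xor Z) xor (crosses (b , d) r xor W)  ∎
    where
      open ≡-Reasoning
      X = xorMap (crosses (a , b)) R
      Y = xorMap (crosses (c , d)) R
      Z = xorMap (crosses (a , c)) R
      W = xorMap (crosses (b , d)) R
      swap-middle : ∀ p x q y → (p xor x) xor (q xor y) ≡ (p xor q) xor (x xor y)
      swap-middle = solve 4 (λ p x q y → (p :+ x) :+ (q :+ y) := (p :+ q) :+ (x :+ y)) refl

  crossingParity-switch : ∀ (a b c d : Fin m) R → Unique (a ∷ b ∷ c ∷ d ∷ endpoints R) →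
    crossingParity ((a , b) ∷ (c , d) ∷ R) xor crossingParity ((a , c) ∷ (b , d) ∷ R) ≡
    crosses (a , b) (c , d) xor crosses (a , c) (b , d)
  crossingParity-switch a b c d R u@((a≢b ∷ a≢c ∷ a≢d ∷ a∉) ∷ (b≢c ∷ b≢d ∷ b∉) ∷ (c≢d ∷ c∉) ∷ d∉ ∷ uR) = begin
    ((ab,cd xor X) xor (Y xor P)) xor ((ac,bd xor Z) xor (W xor P))
      ≡⟨ solve 7 (λ A B X Y Z W P → ((A :+ X) :+ (Y :+ P)) :+ ((B :+ Z) :+ (W :+ P)) := (A :+ B) :+ ((X :+ Y) :+ (Z :+ W)))
           refl ab,cd ac,bd X Y Z W P ⟩
    (ab,cd xor ac,bd) xor ((X xor Y) xor (Z xor W))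
      ≡⟨ cong (λ s → (ab,cd xor ac,bd) xor (s xor (Z xor W)))
              (xorMap-regroup R (Disjoint-all R a≢b a∉ b∉ uR) (Disjoint-all R c≢d c∉ d∉ uR)
                                (Disjoint-all R a≢c a∉ c∉ uR) (Disjoint-all R b≢d b∉ d∉ uR)) ⟩
    (ab,cd xor ac,bd) xor ((Z xor W) xor (Z xor W))
      ≡⟨ solve 2 (λ A S → A :+ (S :+ S) := A) refl (ab,cd xor ac,bd) (Z xor W) ⟩
    ab,cd xor ac,bd ∎
    where
      open ≡-Reasoning
      ab,cd = crosses (a , b) (c , d)
      ac,bd = crosses (a , c) (b , d)
      X = xorMap (crosses (a , b)) R
      Y = xorMap (crosses (c , d)) R
      Z = xorMap (crosses (a , c)) R
      W = xorMap (crosses (b , d)) R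
      P = crossingParity R

  pairings-cross-once : ∀ {a b c d : Fin m} → Distinct₄ a b c d →
    (crosses (a , b) (c , d) xor crosses (a , c) (b , d)) xor crosses (a , d) (b , c) ≡ true
  pairings-cross-once {a} {b} {c} {d} abcd@record { ab = a≢b ; ap = a≢c ; aq = a≢d ; bp = b≢c ; bq = b≢d ; pq = c≢d }
    rewrite crosses≡separates abcd
          | crosses≡separates {a = a} {b = c} {p = b} {q = d}
              (record { ab = a≢c ; ap = a≢b ; aq = a≢d ; bp = b≢c ∘ sym ; bq = c≢d ; pq = b≢d })
          | crosses≡separates {a = a} {b = d} {p = b} {q = c}
              (record { ab = a≢d ; ap = a≢b ; aq = a≢c ; bp = b≢d ∘ sym ; bq = c≢d ∘ sym ; pq = b≢c })
          | <ᵇ-flip c b (b≢c ∘ sym) | <ᵇ-flip c d c≢d | <ᵇ-flip d b (b≢d ∘ sym) =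
    solve 6 (λ ca cb da db ba cd →
               (((ca :+ cb) :+ da) :+ db) :+ (((ba :+ (con true :+ cb)) :+ da) :+ (con true :+ cd))
                 :+ (((ba :+ (con true :+ db)) :+ ca) :+ cd) := con true)
      refl (c <ᵇ a) (c <ᵇ b) (d <ᵇ a) (d <ᵇ b) (b <ᵇ a) (c <ᵇ d)

  module _ (τ : Fin m → Fin m) (τ-inj : Injective _≡_ _≡_ τ) where

    PreservesParity : List (Chord m) → Set
    PreservesParity cs = crossingParity (map (mapChord τ) cs) ≡ crossingParity cs

    crosses-switch-preserved : ∀ (a b c d : Fin m) R → Unique (a ∷ b ∷ c ∷ d ∷ endpoints R) →
      PreservesParity ((a , b) ∷ (c , d) ∷ R) → PreservesParity ((a , c) ∷ (b , d) ∷ R) →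
      crosses (τ a , τ b) (τ c , τ d) xor crosses (τ a , τ c) (τ b , τ d) ≡ crosses (a , b) (c , d) xor crosses (a , c) (b , d)
    crosses-switch-preserved a b c d R u p₁ p₂ = begin
      crosses (τ a , τ b) (τ c , τ d) xor crosses (τ a , τ c) (τ b , τ d)
        ≡⟨ sym (crossingParity-switch (τ a) (τ b) (τ c) (τ d) (map (mapChord τ) R) τu) ⟩
      crossingParity (map (mapChord τ) ((a , b) ∷ (c , d) ∷ R)) xor crossingParity (map (mapChord τ) ((a , c) ∷ (b , d) ∷ R))
        ≡⟨ cong₂ _xor_ p₁ p₂ ⟩
      crossingParity ((a , b) ∷ (c , d) ∷ R) xor crossingParity ((a , c) ∷ (b , d) ∷ R)
        ≡⟨ crossingParity-switch a b c d R u ⟩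
      crosses (a , b) (c , d) xor crosses (a , c) (b , d) ∎
      where
        open ≡-Reasoning
        τu : Unique (τ a ∷ τ b ∷ τ c ∷ τ d ∷ endpoints (map (mapChord τ) R))
        τu = subst (λ es → Unique (τ a ∷ τ b ∷ τ c ∷ τ d ∷ es)) (sym (endpoints-map τ R)) (Unique.map⁺ τ-inj u)

    -- The three pairings give X ⊕ Y, X ⊕ Z and X ⊕ Y ⊕ Z = true, which determine X.
    crosses-preserved : ∀ (a b c d : Fin m) R → Unique (a ∷ b ∷ c ∷ d ∷ endpoints R) →
      PreservesParity ((a , b) ∷ (c , d) ∷ R) → PreservesParity ((a , c) ∷ (b , d) ∷ R) →
      PreservesParity ((a , b) ∷ (d , c) ∷ R) → PreservesParity ((a , d) ∷ (b , c) ∷ R) →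
      crosses (τ a , τ b) (τ c , τ d) ≡ crosses (a , b) (c , d)
    crosses-preserved a b c d R u p₁ p₂ p₃ p₄ = begin
      Xτ                                   ≡⟨ determined Xτ Yτ Zτ ⟩
      ((Xτ xor Yτ) xor Zτ) xor ((Xτ xor Yτ) xor (Xτ xor Zτ))
                                           ≡⟨ cong₂ (λ s t → s xor (t xor (Xτ xor Zτ)))
                                                (pairings-cross-once (Disjoint-map τ-inj d₄))
                                                (crosses-switch-preserved a b c d R u p₁ p₂) ⟩
      true xor ((X xor Y) xor (Xτ xor Zτ))  ≡⟨ cong (λ t → true xor ((X xor Y) xor t)) XZ-preserved ⟩
      true xor ((X xor Y) xor (X xor Z))    ≡⟨ cong (λ s → s xor ((X xor Y) xor (X xor Z))) (sym (pairings-cross-once d₄)) ⟩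
      ((X xor Y) xor Z) xor ((X xor Y) xor (X xor Z))
                                           ≡⟨ sym (determined X Y Z) ⟩
      X                                    ∎
      where
        open ≡-Reasoning
        d₄ : Distinct₄ a b c d
        d₄ = Unique⇒Distinct₄ u
        X  = crosses (a , b) (c , d)
        Y  = crosses (a , c) (b , d)
        Z  = crosses (a , d) (b , c)
        Xτ = crosses (τ a , τ b) (τ c , τ d)
        Yτ = crosses (τ a , τ c) (τ b , τ d)
        Zτ = crosses (τ a , τ d) (τ b , τ c)
        determined : ∀ x y z → x ≡ ((x xor y) xor z) xor ((x xor y) xor (x xor z))
        determined = solve 3 (λ x y z → x := ((x :+ y) :+ z) :+ ((x :+ y) :+ (x :+ z))) refl
        u′ : Unique (a ∷ b ∷ d ∷ c ∷ endpoints R)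
        u′ = Unique-resp-↭ (↭.prep a (↭.prep b (↭.swap c d ↭-refl))) u
        XZ-preserved : Xτ xor Zτ ≡ X xor Z
        XZ-preserved = begin
          Xτ xor Zτ                                           ≡⟨ cong (_xor Zτ) (sym (crosses-swapʳ (τ a , τ b) (τ c) (τ d))) ⟩
          crosses (τ a , τ b) (τ d , τ c) xor Zτ              ≡⟨ crosses-switch-preserved a b d c R u′ p₃ p₄ ⟩
          crosses (a , b) (d , c) xor Z                       ≡⟨ cong (_xor Z) (crosses-swapʳ (a , b) c d) ⟩
          X xor Z                                             ∎

  transpose-here : ∀ (q r : Fin m) → PC.transpose q r q ≡ r
  transpose-here q r rewrite dec-true (q F.≟ q) refl = refl

  transpose-elsewhere : ∀ (q r p : Fin m) → p ≢ q → p ≢ r → PC.transpose q r p ≡ p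
  transpose-elsewhere q r p p≢q p≢r rewrite dec-false (p F.≟ q) p≢q | dec-false (p F.≟ r) p≢r = refl

  permutation-sending : ∀ (ps ts : List (Fin m)) → length ps ≡ length ts → Unique ps → Unique ts →
    Σ (Permutation′ m) λ π → map (π ⟨$⟩ʳ_) ps ≡ ts
  permutation-sending []       []       _   _          _          = Perm.id , refl
  permutation-sending (p ∷ ps) (t ∷ ts) len (p∉ ∷ ups) (t∉ ∷ uts) with permutation-sending ps ts (suc-injective len) ups uts
  ... | π , πps≡ts = Perm.transpose p r Perm.∘ₚ π , cong₂ _∷_ sends-p (trans (map-cong-local fixes-ps) πps≡ts)
    where
      r = π ⟨$⟩ˡ t
      sends-p : π ⟨$⟩ʳ PC.transpose p r p ≡ t
      sends-p = trans (cong (π ⟨$⟩ʳ_) (transpose-here p r)) (inverseʳ π)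
      fixes-ps : All (λ q → π ⟨$⟩ʳ PC.transpose p r q ≡ π ⟨$⟩ʳ q) ps
      fixes-ps = All.zipWith (λ (p≢q , t≢πq) → cong (π ⟨$⟩ʳ_) (transpose-elsewhere p r _ (p≢q ∘ sym)
                                 λ q≡r → t≢πq (trans (sym (inverseʳ π)) (cong (π ⟨$⟩ʳ_) (sym q≡r)))))
                   (p∉ , All-map⁻ (subst (All (t ≢_)) (sym πps≡ts) t∉))

  endpoints-pairUp : ∀ k (xs : List (Fin m)) e → endpoints (V.toList (pairUp k xs e)) ≡ xs
  endpoints-pairUp zero    []           _ = refl
  endpoints-pairUp (suc k) (x ∷ y ∷ xs) e = cong (λ es → x ∷ y ∷ es) (endpoints-pairUp k xs _)

  matching-through : ∀ k {a b c d : Fin m} → Distinct₄ a b c d → (xs : List (Fin m)) → Unique xs →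
    length xs ≡ suc (suc k) * 2 → Σ (Vec (Chord m) k) λ R → Unique (a ∷ b ∷ c ∷ d ∷ endpoints (V.toList R))
  matching-through k {a} {b} {c} {d} abcd (p₀ ∷ p₁ ∷ p₂ ∷ p₃ ∷ xs) u e
    with permutation-sending (p₀ ∷ p₁ ∷ p₂ ∷ p₃ ∷ []) (a ∷ b ∷ c ∷ d ∷ []) refl
           (Distinct₄⇒Unique (Unique⇒Distinct₄ u)) (Distinct₄⇒Unique abcd)
  ... | π , π≡ = R , subst Unique images (Unique.map⁺ (⟨$⟩ʳ-injective π) u)
    where
      S = pairUp k xs (suc-injective (suc-injective (suc-injective (suc-injective e))))
      R = V.map (mapChord (π ⟨$⟩ʳ_)) S
      images : map (π ⟨$⟩ʳ_) (p₀ ∷ p₁ ∷ p₂ ∷ p₃ ∷ xs) ≡ a ∷ b ∷ c ∷ d ∷ endpoints (V.toList R)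
      images = cong₂ _++_ π≡ (sym (begin
        endpoints (V.toList R)                                 ≡⟨ cong endpoints (toList-map (mapChord (π ⟨$⟩ʳ_)) S) ⟩
        endpoints (map (mapChord (π ⟨$⟩ʳ_)) (V.toList S))      ≡⟨ endpoints-map (π ⟨$⟩ʳ_) (V.toList S) ⟩
        map (π ⟨$⟩ʳ_) (endpoints (V.toList S))                 ≡⟨ cong (map (π ⟨$⟩ʳ_)) (endpoints-pairUp k xs _) ⟩
        map (π ⟨$⟩ʳ_) xs                                       ∎))
        where open ≡-Reasoning

ParityInvariant : ∀ n → (Fin (2 * n) → Fin (2 * n)) → Set
ParityInvariant n τ = ∀ (v : Vec (Chord (2 * n)) n) → IsMatching (V.toList v) →
  crossingParity (map (mapChord τ) (V.toList v)) ≡ crossingParity (V.toList v)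

parityInvariant⇒preservesCrossings : ∀ k (τ : Fin (2 * suc (suc k)) → Fin (2 * suc (suc k))) → Injective _≡_ _≡_ τ →
  ParityInvariant (suc (suc k)) τ → PreservesCrossings τ
parityInvariant⇒preservesCrossings k τ τ-inj invariant (a , b) (c , d) abcd with
  matching-through k abcd (allFin (2 * n)) (allFin⁺ (2 * n)) (trans (length-tabulate (λ i → i)) (*-comm 2 n))
  where n = suc (suc k)
... | R , u = crosses-preserved τ τ-inj a b c d (V.toList R) u
  (invariant ((a , b) ∷ (c , d) ∷ R) u)
  (invariant ((a , c) ∷ (b , d) ∷ R) (Unique-resp-↭ (↭.prep a (↭.swap b c ↭-refl)) u))
  (invariant ((a , b) ∷ (d , c) ∷ R) (Unique-resp-↭ (↭.prep a (↭.prep b (↭.swap c d ↭-refl))) u))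
  (invariant ((a , d) ∷ (b , c) ∷ R) (Unique-resp-↭ (↭.prep a (↭-trans (↭.prep b (↭.swap c d ↭-refl)) (↭.swap b d ↭-refl))) u))

-- Symmetries preserving crossings are dihedral

module _ (m : ℕ) .{{_ : NonZero m}} where
  open import Data.Nat using (_+_; _≟_; _<?_)
  open import Data.Nat.Properties
  open import Data.Nat.DivMod

  next : ℕ → ℕ
  next x = (x + 1) % m

  [m%n+k]%n≡[m+k]%n : ∀ a b → ((a % m) + b) % m ≡ (a + b) % m
  [m%n+k]%n≡[m+k]%n a b =
    trans (%-distribˡ-+ (a % m) b m) (trans (cong (λ z → (z + b % m) % m) (m%n%n≡m%n a m)) (sym (%-distribˡ-+ a b m)))

  next-% : ∀ x → next (x % m) ≡ next x
  next-% x = [m%n+k]%n≡[m+k]%n x 1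

  next-+ : ∀ a j → next ((a + j) % m) ≡ (a + suc j) % m
  next-+ a j = trans (next-% (a + j)) (cong (_% m) (trans (+-assoc a j 1) (cong (a +_) (+-comm j 1))))

  next-below : ∀ x → suc x < m → next x ≡ suc x
  next-below x x+1<m = trans (cong (_% m) (+-comm x 1)) (m<n⇒m%n≡m x+1<m)

  next-top : ∀ x → suc x ≡ m → next x ≡ 0
  next-top x x+1≡m = trans (cong (_% m) (trans (+-comm x 1) x+1≡m)) (n%n≡0 m)

  next-injective : ∀ x y → x < m → y < m → next x ≡ next y → x ≡ y
  next-injective x y x<m y<m e with suc x ≟ m | suc y ≟ m
  ... | yes x+1≡m | yes y+1≡m = suc-injective (trans x+1≡m (sym y+1≡m))
  ... | no  x+1≢m | no  y+1≢m =
    suc-injective (trans (sym (next-below x (≤∧≢⇒< x<m x+1≢m))) (trans e (next-below y (≤∧≢⇒< y<m y+1≢m))))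
  ... | yes x+1≡m | no  y+1≢m = ⊥-elim (1+n≢0 (trans (sym (next-below y (≤∧≢⇒< y<m y+1≢m))) (trans (sym e) (next-top x x+1≡m))))
  ... | no  x+1≢m | yes y+1≡m = ⊥-elim (1+n≢0 (trans (sym (next-below x (≤∧≢⇒< x<m x+1≢m))) (trans e (next-top y y+1≡m))))

  +-%-cancelʳ : ∀ a b j → a < m → b < m → (a + j) % m ≡ (b + j) % m → a ≡ b
  +-%-cancelʳ a b zero    a<m b<m e =
    trans (sym (m<n⇒m%n≡m a<m))
          (trans (cong (_% m) (sym (+-identityʳ a))) (trans e (trans (cong (_% m) (+-identityʳ b)) (m<n⇒m%n≡m b<m))))
  +-%-cancelʳ a b (suc j) a<m b<m e = +-%-cancelʳ a b j a<m b<m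
    (next-injective _ _ (m%n<n (a + j) m) (m%n<n (b + j) m) (trans (next-+ a j) (trans e (sym (next-+ b j)))))

  Adjacent : ℕ → ℕ → Set
  Adjacent x y = y ≡ next x ⊎ x ≡ next y

  -- An injective walk through 0, 1, …, m−1 along adjacent vertices of the m-gon
  -- keeps going in the direction of its first step.
  module AdjacentWalk (v : ℕ → ℕ) (v<m : ∀ j → v j < m) (v-injective : ∀ j j′ → j < m → j′ < m → v j ≡ v j′ → j ≡ j′)
                      (step : ∀ j → suc j < m → Adjacent (v j) (v (suc j))) where

    j≢j+2 : ∀ j → suc (suc j) ≢ j
    j≢j+2 j e = <-irrefl (sym e) (<-trans (n<1+n j) (n<1+n (suc j)))

    v0%m : v 0 % m ≡ v 0
    v0%m = m<n⇒m%n≡m (v<m 0)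

    Rotation : ℕ → Set
    Rotation j = v j ≡ (v 0 + j) % m

    Reflection : ℕ → Set
    Reflection j = (v j + j) % m ≡ v 0

    rotation-walk : v 1 ≡ next (v 0) → ∀ j → suc j < m → Rotation j × Rotation (suc j)
    rotation-walk h zero    _ = sym (trans (cong (_% m) (+-identityʳ (v 0))) v0%m) , h
    rotation-walk h (suc j) j+2<m with rotation-walk h j (<-trans (n<1+n (suc j)) j+2<m)
    ... | rot-j , rot-j+1 with step (suc j) j+2<m
    ... | inj₁ forward  = rot-j+1 , trans forward (trans (cong next rot-j+1) (next-+ (v 0) (suc j)))
    ... | inj₂ backward = ⊥-elim (j≢j+2 j (v-injective _ _ j+2<m (<-trans (<-trans (n<1+n j) (n<1+n (suc j))) j+2<m)
            (next-injective _ _ (v<m _) (v<m _) (trans (sym backward) (trans rot-j+1 (trans (sym (next-+ (v 0) j)) (cong next (sym rot-j))))))))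

    reflection-walk : v 0 ≡ next (v 1) → ∀ j → suc j < m → Reflection j × Reflection (suc j)
    reflection-walk h zero    _ = trans (cong (_% m) (+-identityʳ (v 0))) v0%m , sym h
    reflection-walk h (suc j) j+2<m with reflection-walk h j (<-trans (n<1+n (suc j)) j+2<m)
    ... | refl-j , refl-j+1 with step (suc j) j+2<m
    ... | inj₂ backward = refl-j+1 , (begin
      (v (2 + j) + suc (suc j)) % m            ≡⟨ cong (_% m) (sym (+-assoc (v (2 + j)) 1 (suc j))) ⟩
      (v (2 + j) + 1 + suc j) % m              ≡⟨ sym ([m%n+k]%n≡[m+k]%n (v (2 + j) + 1) (suc j)) ⟩
      (next (v (2 + j)) + suc j) % m           ≡⟨ cong (λ z → (z + suc j) % m) (sym backward) ⟩
      (v (suc j) + suc j) % m                  ≡⟨ refl-j+1 ⟩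
      v 0                                      ∎)
      where open ≡-Reasoning
    ... | inj₁ forward = ⊥-elim (j≢j+2 j (v-injective _ _ j+2<m (<-trans (<-trans (n<1+n j) (n<1+n (suc j))) j+2<m)
            (+-%-cancelʳ _ _ j (v<m _) (v<m _) (begin
              (v (2 + j) + j) % m                  ≡⟨ cong (λ z → (z + j) % m) forward ⟩
              (next (v (suc j)) + j) % m           ≡⟨ [m%n+k]%n≡[m+k]%n (v (suc j) + 1) j ⟩
              (v (suc j) + 1 + j) % m              ≡⟨ cong (_% m) (+-assoc (v (suc j)) 1 j) ⟩
              (v (suc j) + suc j) % m              ≡⟨ trans refl-j+1 (sym refl-j) ⟩
              (v j + j) % m                        ∎))))
      where open ≡-Reasoning

    walk : 2 ≤ m → (∀ j → j < m → Rotation j) ⊎ (∀ j → j < m → Reflection j)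
    walk 2≤m with step 0 2≤m
    ... | inj₁ forward  = inj₁ λ { zero    _     → proj₁ (rotation-walk forward 0 2≤m)
                                 ; (suc j) j+1<m → proj₂ (rotation-walk forward j j+1<m) }
    ... | inj₂ backward = inj₂ λ { zero    _     → proj₁ (reflection-walk backward 0 2≤m)
                                 ; (suc j) j+1<m → proj₂ (reflection-walk backward j j+1<m) }

  fin : ℕ → Fin m
  fin j = F.fromℕ< (m%n<n j m)

  toℕ-fin : ∀ j → j < m → toℕ (fin j) ≡ j
  toℕ-fin j j<m = trans (toℕ-fromℕ< (m%n<n j m)) (m<n⇒m%n≡m j<m)

  fin-toℕ : ∀ (i : Fin m) → fin (toℕ i) ≡ i
  fin-toℕ i = toℕ-injective (toℕ-fin (toℕ i) (toℕ<n i))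

  consecutive-crosses-nothing : ∀ {i i⁺ p q : Fin m} → toℕ i⁺ ≡ suc (toℕ i) → Distinct₄ i i⁺ p q →
    crosses (i , i⁺) (p , q) ≡ false
  consecutive-crosses-nothing {i} {i⁺} {p} {q} i⁺≡i+1 d
    rewrite crosses≡separates d | i⁺≡i+1
          | <ᵇ-suc (toℕ p) (toℕ i) (Distinct₄.ap d ∘ sym ∘ toℕ-injective)
          | <ᵇ-suc (toℕ q) (toℕ i) (Distinct₄.aq d ∘ sym ∘ toℕ-injective) =
    solve 2 (λ x y → ((x :+ x) :+ y) :+ y := con false) refl (p <ᵇ i) (q <ᵇ i)

  Crossed : Fin m → Fin m → Set
  Crossed x y = Σ (Chord m) λ c → Disjoint (x , y) c × crosses (x , y) c ≡ true

  crossed-by-between : ∀ {x y u w : Fin m} → toℕ x < toℕ u → toℕ u < toℕ y → toℕ w < toℕ x ⊎ toℕ y < toℕ w → Crossed x y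
  crossed-by-between {x} {y} {u} {w} x<u u<y w-outside = (u , w) , d w-outside , c w-outside
    where
      x<y = <-trans x<u u<y
      ≢ : ∀ {a b : Fin m} → toℕ a < toℕ b → a ≢ b
      ≢ a<b refl = <-irrefl refl a<b
      d : toℕ w < toℕ x ⊎ toℕ y < toℕ w → Distinct₄ x y u w
      d (inj₁ w<x) = record { ab = ≢ x<y ; ap = ≢ x<u ; aq = ≢ w<x ∘ sym ; bp = ≢ u<y ∘ sym
                            ; bq = ≢ (<-trans w<x x<y) ∘ sym ; pq = ≢ (<-trans w<x x<u) ∘ sym }
      d (inj₂ y<w) = record { ab = ≢ x<y ; ap = ≢ x<u ; aq = ≢ (<-trans x<y y<w) ; bp = ≢ u<y ∘ sym
                            ; bq = ≢ y<w ; pq = ≢ (<-trans u<y y<w) }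
      c : ∀ outside → crosses (x , y) (u , w) ≡ true
      c outside rewrite crosses≡separates (d outside) | ≮ᵇ-complete {toℕ u} {toℕ x} (<⇒≤ x<u) | <ᵇ-complete u<y with outside
      ... | inj₁ w<x rewrite <ᵇ-complete w<x | <ᵇ-complete (<-trans w<x x<y) = refl
      ... | inj₂ y<w
        rewrite ≮ᵇ-complete {toℕ w} {toℕ x} (<⇒≤ (<-trans x<y y<w)) | ≮ᵇ-complete {toℕ w} {toℕ y} (<⇒≤ y<w) = refl

  nonadjacent-crossed< : ∀ (x y : Fin m) → toℕ x < toℕ y → toℕ y ≢ next (toℕ x) → toℕ x ≢ next (toℕ y) → Crossed x y
  nonadjacent-crossed< x y x<y y≢x+1 x≢y+1 = crossed-by-between x<u u<y (proj₂ (outside (X ≟ 0)))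
    where
      X = toℕ x
      Y = toℕ y
      x+1<m : suc X < m
      x+1<m = ≤-<-trans x<y (toℕ<n y)
      u = fin (suc X)
      x<u : X < toℕ u
      x<u = subst (X <_) (sym (toℕ-fin (suc X) x+1<m)) (n<1+n X)
      u<y : toℕ u < Y
      u<y = subst (_< Y) (sym (toℕ-fin (suc X) x+1<m)) (≤∧≢⇒< x<y (λ e → y≢x+1 (trans (sym e) (sym (next-below X x+1<m)))))
      outside : Dec (X ≡ 0) → Σ (Fin m) λ w → toℕ w < X ⊎ Y < toℕ w
      outside (yes x≡0) = fin (suc Y) , inj₂ (subst (Y <_) (sym (toℕ-fin (suc Y) y+1<m)) (n<1+n Y))
        where
          y+1<m : suc Y < m
          y+1<m = ≤∧≢⇒< (toℕ<n y) (λ e → x≢y+1 (trans x≡0 (sym (next-top Y e))))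
      outside (no x≢0) = fin 0 , inj₁ (subst (_< X) (sym (toℕ-fin 0 (≤-<-trans z≤n (toℕ<n y)))) (n≢0⇒n>0 x≢0))

  nonadjacent-crossed : ∀ (x y : Fin m) → x ≢ y → toℕ y ≢ next (toℕ x) → toℕ x ≢ next (toℕ y) → Crossed x y
  nonadjacent-crossed x y x≢y y≢x+1 x≢y+1 with toℕ x <? toℕ y
  ... | yes x<y = nonadjacent-crossed< x y x<y y≢x+1 x≢y+1
  ... | no  x≮y with nonadjacent-crossed< y x (≤∧≢⇒< (≮⇒≥ x≮y) (x≢y ∘ sym ∘ toℕ-injective)) x≢y+1 y≢x+1
  ...   | c , d , cr = c , record { ab = ab ∘ sym ; ap = bp ; aq = bq ; bp = ap ; bq = aq ; pq = pq } , trans (crosses-swapˡ y x c) cr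
    where open Distinct₄ d

  module _ (σ : Permutation′ m) (σ-cross : PreservesCrossings (σ ⟨$⟩ʳ_)) where

    image : ℕ → ℕ
    image j = toℕ (σ ⟨$⟩ʳ fin j)

    consecutive-adjacent : ∀ j → suc j < m → Adjacent (image j) (image (suc j))
    consecutive-adjacent j j+1<m with image (suc j) ≟ next (image j) | image j ≟ next (image (suc j))
    ... | yes forward | _            = inj₁ forward
    ... | no  _       | yes backward = inj₂ backward
    ... | no  n₁      | no  n₂ with nonadjacent-crossed (σ ⟨$⟩ʳ i) (σ ⟨$⟩ʳ i⁺) (i≢i⁺ ∘ ⟨$⟩ʳ-injective σ) n₁ n₂
      where
        i  = fin j
        i⁺ = fin (suc j)
        i≢i⁺ : i ≢ i⁺
        i≢i⁺ e = <-irrefl (trans (sym (toℕ-fin j (<-trans (n<1+n j) j+1<m))) (trans (cong toℕ e) (toℕ-fin (suc j) j+1<m))) (n<1+n j)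
    ... | (u , w) , d , crossed = ⊥-elim (true≢false (begin
      true                                                       ≡⟨ sym crossed ⟩
      crosses (σ ⟨$⟩ʳ i , σ ⟨$⟩ʳ i⁺) (u , w)                      ≡⟨ sym (PreservesCrossings-flip σ σ-cross _ _ d) ⟩
      crosses (σ ⟨$⟩ˡ (σ ⟨$⟩ʳ i) , σ ⟨$⟩ˡ (σ ⟨$⟩ʳ i⁺)) (u′ , w′)  ≡⟨ cong₂ (λ a b → crosses (a , b) (u′ , w′)) (inverseˡ σ) (inverseˡ σ) ⟩
      crosses (i , i⁺) (u′ , w′)                                  ≡⟨ consecutive-crosses-nothing consecutive d′ ⟩
      false                                                       ∎))
      where
        open ≡-Reasoning
        i  = fin j
        i⁺ = fin (suc j)
        u′ = σ ⟨$⟩ˡ u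
        w′ = σ ⟨$⟩ˡ w
        consecutive : toℕ i⁺ ≡ suc (toℕ i)
        consecutive = trans (toℕ-fin (suc j) j+1<m) (cong suc (sym (toℕ-fin j (<-trans (n<1+n j) j+1<m))))
        d′ : Distinct₄ i i⁺ u′ w′
        d′ = subst₂ (λ a b → Distinct₄ a b u′ w′) (inverseˡ σ) (inverseˡ σ) (Disjoint-map (⟨$⟩ʳ-injective (flip σ)) d)

    preservesCrossings⇒dihedral : 2 ≤ m → Dihedral m σ
    preservesCrossings⇒dihedral 2≤m with AdjacentWalk.walk image (λ _ → toℕ<n _) image-injective consecutive-adjacent 2≤m
      where
        image-injective : ∀ j j′ → j < m → j′ < m → image j ≡ image j′ → j ≡ j′
        image-injective j j′ j<m j′<m e =
          trans (sym (toℕ-fin j j<m)) (trans (cong toℕ (⟨$⟩ʳ-injective σ (toℕ-injective e))) (toℕ-fin j′ j′<m))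
    ... | inj₁ rotation = image 0 , inj₁ λ i → Equivalence.from (ℤ∣⇔%≡ m (toℕ (σ ⟨$⟩ʳ i)) (toℕ i + image 0)) (begin
      toℕ (σ ⟨$⟩ʳ i) % m     ≡⟨ m<n⇒m%n≡m (toℕ<n _) ⟩
      toℕ (σ ⟨$⟩ʳ i)         ≡⟨ cong (λ z → toℕ (σ ⟨$⟩ʳ z)) (sym (fin-toℕ i)) ⟩
      image (toℕ i)          ≡⟨ rotation (toℕ i) (toℕ<n i) ⟩
      (image 0 + toℕ i) % m  ≡⟨ cong (_% m) (+-comm (image 0) (toℕ i)) ⟩
      (toℕ i + image 0) % m  ∎)
      where open ≡-Reasoning
    ... | inj₂ reflection = image 0 , inj₂ λ i → Equivalence.from (ℤ∣⇔%≡ m (toℕ (σ ⟨$⟩ʳ i) + toℕ i) (image 0)) (begin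
      (toℕ (σ ⟨$⟩ʳ i) + toℕ i) % m  ≡⟨ cong (λ z → (toℕ (σ ⟨$⟩ʳ z) + toℕ i) % m) (sym (fin-toℕ i)) ⟩
      (image (toℕ i) + toℕ i) % m   ≡⟨ reflection (toℕ i) (toℕ<n i) ⟩
      image 0                       ≡⟨ sym (m<n⇒m%n≡m (toℕ<n _)) ⟩
      image 0 % m                   ∎)
      where open ≡-Reasoning

dihedral-2 : ∀ (σ : Permutation′ 2) → Dihedral 2 σ
dihedral-2 σ = toℕ (σ ⟨$⟩ʳ F.zero) , inj₁ λ i →
  Equivalence.from (ℤ∣⇔%≡ 2 (toℕ (σ ⟨$⟩ʳ i)) (toℕ i ℕ.+ toℕ (σ ⟨$⟩ʳ F.zero))) (shift i)
  where
    σ-injective : σ ⟨$⟩ʳ F.zero ≢ σ ⟨$⟩ʳ F.suc F.zero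
    σ-injective e with ⟨$⟩ʳ-injective σ e
    ... | ()
    shift : ∀ i → toℕ (σ ⟨$⟩ʳ i) % 2 ≡ (toℕ i ℕ.+ toℕ (σ ⟨$⟩ʳ F.zero)) % 2
    shift F.zero           = refl
    shift (F.suc F.zero) with σ ⟨$⟩ʳ F.zero in e₀ | σ ⟨$⟩ʳ F.suc F.zero in e₁
    ... | F.zero       | F.suc F.zero = refl
    ... | F.suc F.zero | F.zero       = refl
    ... | F.zero       | F.zero       = ⊥-elim (σ-injective (trans e₀ (sym e₁)))
    ... | F.suc F.zero | F.suc F.zero = ⊥-elim (σ-injective (trans e₀ (sym e₁)))

module _ {c ℓ} (R : CommutativeRing c ℓ) where
  open CommutativeRing R using (_≈_; _+_; 1#; 0#)

  pf-fixed⇒dihedral : ¬ (1# + 1# ≈ 0#) → ∀ k (σ : Permutation′ (2 * suc k)) →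
    Poly._≈ₚ_ R (2 * suc k) (Poly.act R (2 * suc k) σ (pf R (suc k))) (pf R (suc k)) → Dihedral (2 * suc k) σ
  pf-fixed⇒dihedral 1+1≉0 zero     σ _     = dihedral-2 σ
  pf-fixed⇒dihedral 1+1≉0 (suc k′) σ fixed =
    preservesCrossings⇒dihedral (2 * suc (suc k′)) σ
      (parityInvariant⇒preservesCrossings k′ (σ ⟨$⟩ʳ_) (⟨$⟩ʳ-injective σ)
        (PfaffianCoefficients.fixes-pf⇒crossingParity R (suc (suc k′)) 1+1≉0 σ fixed))
      (s≤s (s≤s z≤n))

  dihedral⇒pf-fixed : ∀ k (σ : Permutation′ (2 * suc k)) → Dihedral (2 * suc k) σ →
    Poly._≈ₚ_ R (2 * suc k) (Poly.act R (2 * suc k) σ (pf R (suc k))) (pf R (suc k))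
  dihedral⇒pf-fixed k σ dihedral μ rewrite Coefficients.coeff-act R (2 * suc k) σ μ (pf R (suc k)) =
    PfaffianCoefficients.coeff-pf-relabel R (suc k) σ
      (twisted⇒PreservesCrossings (dihedral⇒TwistedOrder (2 * suc k) σ dihedral) (⟨$⟩ʳ-injective σ)) μ

theorem1p1 : ∀ {c ℓ} (K : Field c ℓ) → CharNot2 K → (n : ℕ) → 1 ≤ n → (σ : Permutation′ (2 * n)) → (Poly._≈ₚ_ (Field.commutativeRing K) (2 * n) (Poly.act (Field.commutativeRing K) (2 * n) σ (pf (Field.commutativeRing K) n)) (pf (Field.commutativeRing K) n) ⇔ Dihedral (2 * n) σ)
theorem1p1 K char≢2 (suc k) _ σ =
  mk⇔ (pf-fixed⇒dihedral (Field.commutativeRing K) char≢2 k σ) (dihedral⇒pf-fixed (Field.commutativeRing K) k σ)
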